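{- Let $k\ge 0$ and $n\ge k+4$ be integers, and let $S\subseteq[3,n-k-1]$ with $CP_n(S)\ne\emptyset$. Then $$cp_n(S\cup[n-k+1,n]) = 2(k+1)\,cp_{n-1}(S\cup[n-k,n-1]) + k(k+1)\,cp_{n-2}(S\cup[n-k,n-2]).$$
   Context: For integers $a \le b$, $[a,b]=\{a,a+1,\dots,b\}$, $[a,b]=\emptyset$ if $a>b$, and $[n]=[1,n]$. For $m\ge1$, $\mathfrak{S}_m$ is the set of permutations of $[m]$, written in one-line form $\sigma=(\sigma(1)\cdots\sigma(m))$. The circular peak set of $\sigma\in\mathfrak{S}_m$ is $CP(\sigma)=\{\sigma(i) : 2\le i\le m-1,\ \sigma(i-1)<\sigma(i)>\sigma(i+1)\}$. For $S\subseteq[m]$, $CP_m(S)=\{\sigma\in\mathfrak{S}_m : CP(\sigma)=S\}$ and $cp_m(S)=|CP_m(S)|$. -}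

module Defs where

open import Data.Nat using (ℕ; zero; suc; _+_; _∸_; _<ᵇ_; _≡ᵇ_)
open import Data.Bool using (Bool; true; false; _∧_; _∨_; not; if_then_else_)
open import Data.List using (List; []; _∷_; map; filter; length; upTo; concatMap)
open import Data.Bool.ListAction using (all; any)
open import Relation.Nullary.Decidable using ()
open import Data.Bool.Properties using (T?)

-- [a,b] = {a, a+1, ..., b}  (empty if a > b)
range : ℕ → ℕ → List ℕ
range a b = map (a +_) (upTo (suc b ∸ a))

[_] : ℕ → List ℕ
[ m ] = range 1 m

words : ℕ → List ℕ → List (List ℕ)
words zero    A = [] ∷ []
words (suc l) A = concatMap (λ a → map (a ∷_) (words l A)) A

memB : ℕ → List ℕ → Bool
memB x xs = any (x ≡ᵇ_) xs

distinctB : List ℕ → Bool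
distinctB []       = true
distinctB (x ∷ xs) = not (memB x xs) ∧ distinctB xs

-- 𝔖_m : permutations of [m] in one-line form
-- (words of length m over [m] with distinct entries)
perms : ℕ → List (List ℕ)
perms m = filter (λ σ → T? (distinctB σ)) (words m [ m ])

-- CP(σ) : values σ(i), 2 ≤ i ≤ m-1, with σ(i-1) < σ(i) > σ(i+1)
peaks : List ℕ → List ℕ
peaks (a ∷ b ∷ c ∷ rest) =
  if (a <ᵇ b) ∧ (c <ᵇ b) then b ∷ peaks (b ∷ c ∷ rest) else peaks (b ∷ c ∷ rest)
peaks _ = []

cpEqB : List ℕ → List ℕ → Bool
cpEqB σ S = all (λ x → memB x (peaks σ)) S ∧ all (λ x → memB x S) (peaks σ)

cp : ℕ → List ℕ → ℕ
cp m S = length (filter (λ σ → T? (cpEqB σ S)) (perms m))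

-- Write v = n − k.  In a permutation counted on the left every value above v is a peak, so no two
-- such values are adjacent, and v itself is not a peak.  If some neighbour of v is smaller than v,
-- deleting v leaves the peak set unchanged and standardising gives a permutation of [n−1] with peak
-- set S ∪ [v, n−1]; conversely v can be put back at either end or on either side of any of the k
-- values above v, which is 2(k+1) choices.  Otherwise the neighbours of v are peaks above v; deleting
-- v together with its right neighbour t (its left one if v is last) removes exactly the peak t, and
-- standardising gives a permutation of [n−2] with peak set S ∪ [v, n−2].  Conversely, for each of
-- the k values t, "v t" can be put in front, "t v" at the end, or "v t" right after any of the k−1
-- values above v other than t, which is k(k+1) choices.

module Submission where

open import Defs
open import Data.Bool using (true; false; T; _∧_; if_then_else_)
open import Data.Bool.Properties using (T?; T-∧; T-≡)
open import Data.Empty using (⊥; ⊥-elim)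
open import Data.List using (List; []; _∷_; _++_; _∷ʳ_; map; filter; length; upTo; concatMap; head; last; initLast; _∷ʳ′_)
open import Data.List.Properties using (length-map; length-++; length-upTo; map-injective; ++-assoc; ++-identityʳ; ∷-injective; ∷-injectiveˡ; ∷-injectiveʳ; ∷ʳ-injectiveʳ; map-++; filter-accept; filter-reject)
open import Data.List.Membership.Propositional using (_∈_; _∉_; find)
open import Data.List.Membership.Propositional.Properties
open import Data.List.Relation.Unary.All as All using (All; []; _∷_)
open import Data.List.Relation.Unary.All.Properties using (all⁺; all⁻; ¬Any⇒All¬) renaming (map⁺ to All-map⁺)
open import Data.List.Relation.Unary.Any as Any using (Any; here; there)
open import Data.List.Relation.Unary.Any.Properties using (any⁺; any⁻)
open import Data.List.Relation.Unary.Unique.Propositional using (Unique; []; _∷_)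
open import Data.List.Relation.Unary.Unique.Propositional.Properties
open import Data.Maybe using (just; nothing; fromMaybe)
open import Data.Maybe.Relation.Unary.All as Maybe using (just; nothing)
open import Data.Nat using (ℕ; zero; suc; pred; _+_; _*_; _∸_; _≤_; _<_; z≤n; s≤s; _<ᵇ_; _≡ᵇ_; _≟_; _<?_; _≤?_)
open import Data.Nat.Properties
open import Data.List.Membership.DecPropositional _≟_ using (_∈?_)
open import Data.Product using (_×_; _,_; proj₁; proj₂; ∃)
open import Data.Sum using (_⊎_; inj₁; inj₂; [_,_]′)
open import Function using (id; _∘_; _⇔_; mk⇔; Equivalence)
open import Relation.Nullary using (¬_; yes; no)
open import Relation.Binary.PropositionalEquality hiding ([_])

module _ {A : Set} where

  length-++-∷ : ∀ (α : List A) x β → length (α ++ x ∷ β) ≡ suc (length (α ++ β))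
  length-++-∷ α x β = begin
    length (α ++ x ∷ β)          ≡⟨ length-++ α ⟩
    length α + suc (length β)    ≡⟨ +-suc (length α) (length β) ⟩
    suc (length α + length β)    ≡⟨ cong suc (length-++ α) ⟨
    suc (length (α ++ β))        ∎
    where open ≡-Reasoning

  []≢∷ʳ : ∀ (α : List A) {y} → [] ≢ α ∷ʳ y
  []≢∷ʳ []      ()
  []≢∷ʳ (_ ∷ _) ()

  last-∷ʳ : ∀ (α : List A) {x} → last (α ∷ʳ x) ≡ just x
  last-∷ʳ []          = refl
  last-∷ʳ (a ∷ [])    = refl
  last-∷ʳ (a ∷ b ∷ α) = last-∷ʳ (b ∷ α)

  ∈-++-∷⁻ : ∀ {x t : A} α β → x ∈ α ++ t ∷ β → x ≡ t ⊎ x ∈ α ++ β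
  ∈-++-∷⁻ []      β (here e)  = inj₁ e
  ∈-++-∷⁻ []      β (there p) = inj₂ p
  ∈-++-∷⁻ (a ∷ α) β (here e)  = inj₂ (here e)
  ∈-++-∷⁻ (a ∷ α) β (there p) with ∈-++-∷⁻ α β p
  ... | inj₁ e = inj₁ e
  ... | inj₂ q = inj₂ (there q)

  ∈-++-∷⁺ : ∀ {x t : A} α β → x ∈ α ++ β → x ∈ α ++ t ∷ β
  ∈-++-∷⁺ []      β p         = there p
  ∈-++-∷⁺ (a ∷ α) β (here e)  = here e
  ∈-++-∷⁺ (a ∷ α) β (there p) = there (∈-++-∷⁺ α β p)

  ∈-∷ʳ-extend : ∀ {x y : A} α β → x ∈ α ++ y ∷ [] → x ∈ α ++ y ∷ β
  ∈-∷ʳ-extend []      β (here e)  = here e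
  ∈-∷ʳ-extend (a ∷ α) β (here e)  = here e
  ∈-∷ʳ-extend (a ∷ α) β (there p) = there (∈-∷ʳ-extend α β p)

  ∉-++-∷ : ∀ {x t : A} α β → x ≢ t → x ∉ α ++ β → x ∉ α ++ t ∷ β
  ∉-++-∷ α β x≢t x∉ p with ∈-++-∷⁻ α β p
  ... | inj₁ e = x≢t e
  ... | inj₂ q = x∉ q

  Unique-∉-split : ∀ (α : List A) {x β} → Unique (α ++ x ∷ β) → x ∉ α ++ β
  Unique-∉-split []      (x∉β ∷ _) p = All.lookup x∉β p refl
  Unique-∉-split (a ∷ α) (a∉ ∷ u)  (here refl) = All.lookup a∉ (∈-insert α) refl
  Unique-∉-split (a ∷ α) (_ ∷ u)   (there p)   = Unique-∉-split α u p

  Unique-remove : ∀ (α : List A) {x β} → Unique (α ++ x ∷ β) → Unique (α ++ β)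
  Unique-remove []      (_ ∷ u)  = u
  Unique-remove (a ∷ α) (a∉ ∷ u) = All.tabulate (λ p → All.lookup a∉ (∈-++-∷⁺ α _ p)) ∷ Unique-remove α u

  Unique-insert : ∀ (α : List A) {x β} → Unique (α ++ β) → x ∉ α ++ β → Unique (α ++ x ∷ β)
  Unique-insert []      u x∉ = All.tabulate (λ p e → x∉ (subst (_∈ _) (sym e) p)) ∷ u
  Unique-insert (a ∷ α) (a∉ ∷ u) x∉ =
    All.tabulate (λ p → a∉′ (∈-++-∷⁻ α _ p)) ∷ Unique-insert α u (x∉ ∘ there)
    where
    a∉′ : ∀ {y} → y ≡ _ ⊎ y ∈ α ++ _ → a ≢ y
    a∉′ (inj₁ refl) a≡x = x∉ (here (sym a≡x))
    a∉′ (inj₂ q)        = All.lookup a∉ q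

  ++-∷-cancel : ∀ {x : A} α β α′ β′ → x ∉ α → x ∉ α′ → α ++ x ∷ β ≡ α′ ++ x ∷ β′ → α ≡ α′ × β ≡ β′
  ++-∷-cancel []      β []        β′ _ _ e = refl , proj₂ (∷-injective e)
  ++-∷-cancel []      β (y ∷ α′) β′ _ x∉ e = ⊥-elim (x∉ (here (proj₁ (∷-injective e))))
  ++-∷-cancel (y ∷ α) β []        β′ x∉ _ e = ⊥-elim (x∉ (here (sym (proj₁ (∷-injective e)))))
  ++-∷-cancel (y ∷ α) β (y′ ∷ α′) β′ x∉ x∉′ e with ∷-injective e
  ... | refl , e′ with ++-∷-cancel α β α′ β′ (x∉ ∘ there) (x∉′ ∘ there) e′
  ... | refl , refl = refl , refl

  Unique⊆⇒length≤ : ∀ {xs ys : List A} → Unique xs → (∀ {z} → z ∈ xs → z ∈ ys) → length xs ≤ length ys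
  Unique⊆⇒length≤ {[]}     _         _   = z≤n
  Unique⊆⇒length≤ {x ∷ xs} (x∉ ∷ u) sub with ∈-∃++ (sub (here refl))
  ... | α , β , refl = subst (suc (length xs) ≤_) (sym (length-++-∷ α x β))
    (s≤s (Unique⊆⇒length≤ u λ z∈ → others z∈ (∈-++-∷⁻ α β (sub (there z∈)))))
    where
    others : ∀ {z} → z ∈ xs → z ≡ x ⊎ z ∈ α ++ β → z ∈ α ++ β
    others z∈ (inj₁ refl) = ⊥-elim (All.lookup x∉ z∈ refl)
    others _  (inj₂ q)    = q

  unique∧sameElems⇒length≡ : ∀ {xs ys : List A} → Unique xs → Unique ys →
    (∀ {z} → z ∈ xs → z ∈ ys) → (∀ {z} → z ∈ ys → z ∈ xs) → length xs ≡ length ys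
  unique∧sameElems⇒length≡ ux uy to from = ≤-antisym (Unique⊆⇒length≤ ux to) (Unique⊆⇒length≤ uy from)

module _ {A B : Set} where

  length-concatMap-const : ∀ (f : A → List B) c xs →
    (∀ {x} → x ∈ xs → length (f x) ≡ c) → length (concatMap f xs) ≡ c * length xs
  length-concatMap-const f c [] _ = sym (*-zeroʳ c)
  length-concatMap-const f c (x ∷ xs) h = begin
    length (f x ++ concatMap f xs)             ≡⟨ length-++ (f x) ⟩
    length (f x) + length (concatMap f xs)     ≡⟨ cong₂ _+_ (h (here refl)) (length-concatMap-const f c xs (h ∘ there)) ⟩
    c + c * length xs                          ≡⟨ *-suc c (length xs) ⟨
    c * suc (length xs)                        ∎
    where open ≡-Reasoning

  Unique-concatMap : ∀ (f : A → List B) {xs} → Unique xs → (∀ {x} → x ∈ xs → Unique (f x)) →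
    (∀ {x y z} → x ∈ xs → y ∈ xs → z ∈ f x → z ∈ f y → x ≡ y) → Unique (concatMap f xs)
  Unique-concatMap f {[]} _ _ _ = []
  Unique-concatMap f {x ∷ xs} (x∉ ∷ u) uf shared =
    ++⁺ (uf (here refl)) (Unique-concatMap f u (uf ∘ there) (λ p q → shared (there p) (there q)))
        λ (z∈fx , z∈rest) → disjoint z∈fx (find (∈-concatMap⁻ f {xs = xs} z∈rest))
    where
    disjoint : ∀ {z} → z ∈ f x → ∃ (λ y → y ∈ xs × z ∈ f y) → ⊥
    disjoint z∈fx (y , y∈ , z∈fy) with shared (here refl) (there y∈) z∈fx z∈fy
    ... | refl = All.lookup x∉ y∈ refl

  ∈-concatMap-intro : ∀ (f : A → List B) {xs x z} → x ∈ xs → z ∈ f x → z ∈ concatMap f xs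
  ∈-concatMap-intro f x∈ z∈ = ∈-concatMap⁺ f (Any.map (λ { refl → z∈ }) x∈)

  ∈-concatMap-elim : ∀ (f : A → List B) {xs z} → z ∈ concatMap f xs → ∃ λ x → x ∈ xs × z ∈ f x
  ∈-concatMap-elim f {xs} p = find (∈-concatMap⁻ f {xs = xs} p)

memB⁻ : ∀ {x} xs → T (memB x xs) → x ∈ xs
memB⁻ {x} xs p = Any.map (λ {y} → ≡ᵇ⇒≡ x y) (any⁻ (x ≡ᵇ_) xs p)

memB⁺ : ∀ {x xs} → x ∈ xs → T (memB x xs)
memB⁺ {x} p = any⁺ (x ≡ᵇ_) (Any.map (λ { refl → ≡⇒≡ᵇ x x refl }) p)

distinctB⁻ : ∀ σ → T (distinctB σ) → Unique σ
distinctB⁻ []       _ = []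
distinctB⁻ (x ∷ xs) p with memB x xs in eq
... | false = All.tabulate (λ { y∈ refl → subst T eq (memB⁺ y∈) }) ∷ distinctB⁻ xs p

distinctB⁺ : ∀ {σ} → Unique σ → T (distinctB σ)
distinctB⁺ {[]}     []         = _
distinctB⁺ {x ∷ xs} (x∉ ∷ u) with memB x xs in eq
... | false = distinctB⁺ u
... | true  = All.lookup x∉ (memB⁻ xs (subst T (sym eq) _)) refl

HasPeakSet : List ℕ → (ℕ → Set) → Set
HasPeakSet σ P = (∀ x → x ∈ peaks σ → P x) × (∀ x → P x → x ∈ peaks σ)

HasPeakSet-cong : ∀ σ {P Q : ℕ → Set} → (∀ x → P x → Q x) → (∀ x → Q x → P x) → HasPeakSet σ P → HasPeakSet σ Q
HasPeakSet-cong σ P⇒Q Q⇒P (sound , complete) = (λ x p → P⇒Q x (sound x p)) , (λ x q → complete x (Q⇒P x q))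

cpEqB⁻ : ∀ σ S → T (cpEqB σ S) → HasPeakSet σ (_∈ S)
cpEqB⁻ σ S p with Equivalence.to T-∧ p
... | S⊆peaks , peaks⊆S =
  (λ x q → memB⁻ S (All.lookup (all⁺ _ (peaks σ) peaks⊆S) q)) ,
  (λ x q → memB⁻ (peaks σ) (All.lookup (all⁺ _ S S⊆peaks) q))

cpEqB⁺ : ∀ σ S → HasPeakSet σ (_∈ S) → T (cpEqB σ S)
cpEqB⁺ σ S (sound , complete) = Equivalence.from T-∧
  ( all⁻ _ (All.tabulate (λ {x} q → memB⁺ (complete x q)))
  , all⁻ _ (All.tabulate (λ {x} q → memB⁺ (sound x q))) )

∈-range⁻ : ∀ {a b x} → x ∈ range a b → a ≤ x × x ≤ b
∈-range⁻ {a} {b} p with ∈-map⁻ (a +_) p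
... | i , i∈ , refl = m≤m+n a i , +-bound (∈-upTo⁻ i∈)
  where
  +-bound : ∀ {i} → i < suc b ∸ a → a + i ≤ b
  +-bound {i} i< with a ≤? suc b
  ... | yes a≤ = ≤-pred (subst (a + i <_) (m+[n∸m]≡n a≤) (+-monoʳ-< a i<))
  ... | no a≰ with () ← subst (i <_) (m≤n⇒m∸n≡0 (<⇒≤ (≰⇒> a≰))) i<

∈-range⁺ : ∀ {a b x} → a ≤ x → x ≤ b → x ∈ range a b
∈-range⁺ {a} {b} a≤x x≤b =
  subst (_∈ range a b) (m+[n∸m]≡n a≤x) (∈-map⁺ (a +_) (∈-upTo⁺ (∸-monoˡ-< (s≤s x≤b) a≤x)))

Unique-range : ∀ a b → Unique (range a b)
Unique-range a b = map⁺ (+-cancelˡ-≡ a _ _) (upTo⁺ _)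

length-range : ∀ a b → length (range a b) ≡ suc b ∸ a
length-range a b = trans (length-map (a +_) (upTo (suc b ∸ a))) (length-upTo (suc b ∸ a))

∈-words⁻ : ∀ l A w → w ∈ words l A → length w ≡ l × All (_∈ A) w
∈-words⁻ zero    A .[] (here refl) = refl , []
∈-words⁻ (suc l) A w p with ∈-concatMap-elim (λ a → map (a ∷_) (words l A)) {xs = A} p
... | a , a∈ , q with ∈-map⁻ (a ∷_) q
... | w′ , w′∈ , refl with ∈-words⁻ l A w′ w′∈
... | refl , all∈ = refl , a∈ ∷ all∈

∈-words⁺ : ∀ l A w → length w ≡ l → All (_∈ A) w → w ∈ words l A
∈-words⁺ zero    A []      refl []           = here refl
∈-words⁺ (suc l) A (a ∷ w) refl (a∈ ∷ all∈) =
  ∈-concatMap-intro (λ a → map (a ∷_) (words l A)) a∈ (∈-map⁺ (a ∷_) (∈-words⁺ l A w refl all∈))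

Unique-words : ∀ l A → Unique A → Unique (words l A)
Unique-words zero    A _ = [] ∷ []
Unique-words (suc l) A u =
  Unique-concatMap (λ a → map (a ∷_) (words l A)) u
    (λ _ → map⁺ ∷-injectiveʳ (Unique-words l A u))
    λ _ _ p q → same-head p q
  where
  same-head : ∀ {x y z} → z ∈ map (x ∷_) (words l A) → z ∈ map (y ∷_) (words l A) → x ≡ y
  same-head p q with ∈-map⁻ _ p | ∈-map⁻ _ q
  ... | _ , _ , refl | _ , _ , refl = refl

_∈[1,_] : ℕ → ℕ → Set
x ∈[1, m ] = 1 ≤ x × x ≤ m

IsArrangement : ℕ → ℕ → List ℕ → Set
IsArrangement m l ρ = length ρ ≡ l × Unique ρ × All (_∈[1, m ]) ρ

IsPerm : ℕ → List ℕ → Set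
IsPerm m = IsArrangement m m

∈-perms⁻ : ∀ m σ → σ ∈ perms m → IsPerm m σ
∈-perms⁻ m σ p with ∈-filter⁻ (λ σ → T? (distinctB σ)) {xs = words m [ m ]} p
... | w∈ , distinct with ∈-words⁻ m [ m ] σ w∈
... | len , all∈ = len , distinctB⁻ σ distinct , All.map ∈-range⁻ all∈

∈-perms⁺ : ∀ m σ → IsPerm m σ → σ ∈ perms m
∈-perms⁺ m σ (len , u , bounds) =
  ∈-filter⁺ (λ σ → T? (distinctB σ)) (∈-words⁺ m [ m ] σ len (All.map (λ (l , u) → ∈-range⁺ l u) bounds))
    (distinctB⁺ u)

Unique-perms : ∀ m → Unique (perms m)
Unique-perms m = filter⁺ (λ σ → T? (distinctB σ)) (Unique-words m [ m ] (Unique-range 1 m))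

IsPerm-∈ : ∀ {m σ x} → IsPerm m σ → x ∈[1, m ] → x ∈ σ
IsPerm-∈ {m} {σ} {x} (len , u , bounds) (1≤x , x≤m) with x ∈? σ
... | yes x∈ = x∈
... | no  x∉ = ⊥-elim (1+n≰n (begin
  suc m                    ≡⟨ cong suc len ⟨
  length (x ∷ σ)           ≤⟨ Unique⊆⇒length≤ (All.tabulate (λ { y∈ refl → x∉ y∈ }) ∷ u) ⊆range ⟩
  length (range 1 m)       ≡⟨ length-range 1 m ⟩
  m                        ∎))
  where
  open ≤-Reasoning
  ⊆range : ∀ {z} → z ∈ x ∷ σ → z ∈ range 1 m
  ⊆range (here refl) = ∈-range⁺ 1≤x x≤m
  ⊆range (there z∈)  = let (1≤z , z≤m) = All.lookup bounds z∈ in ∈-range⁺ 1≤z z≤m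

_∪[_,_] : List ℕ → ℕ → ℕ → ℕ → Set
(S ∪[ a , b ]) x = x ∈ S ⊎ (a ≤ x × x ≤ b)

∈-++-range⁻ : ∀ S a b x → x ∈ S ++ range a b → (S ∪[ a , b ]) x
∈-++-range⁻ S a b x p with ∈-++⁻ S p
... | inj₁ q = inj₁ q
... | inj₂ q = inj₂ (∈-range⁻ q)

∈-++-range⁺ : ∀ S a b x → (S ∪[ a , b ]) x → x ∈ S ++ range a b
∈-++-range⁺ S a b x (inj₁ q)         = ∈-++⁺ˡ q
∈-++-range⁺ S a b x (inj₂ (a≤ , ≤b)) = ∈-++⁺ʳ S (∈-range⁺ a≤ ≤b)

-- Opaque: unfolding the enumeration of 𝔖_m during unification is prohibitively expensive.
opaque
  cpList : ℕ → List ℕ → List (List ℕ)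
  cpList m S = filter (λ σ → T? (cpEqB σ S)) (perms m)

  cp≡length-cpList : ∀ m S → cp m S ≡ length (cpList m S)
  cp≡length-cpList m S = refl

  Unique-cpList : ∀ m S → Unique (cpList m S)
  Unique-cpList m S = filter⁺ (λ σ → T? (cpEqB σ S)) (Unique-perms m)

  ∈-cpList⁻ : ∀ {m S a b σ} → σ ∈ cpList m (S ++ range a b) → IsPerm m σ × HasPeakSet σ (S ∪[ a , b ])
  ∈-cpList⁻ {m} {S} {a} {b} {σ} p with ∈-filter⁻ (λ σ → T? (cpEqB σ (S ++ range a b))) {xs = perms m} p
  ... | σ∈ , eqB = ∈-perms⁻ m σ σ∈ ,
    HasPeakSet-cong σ (∈-++-range⁻ S a b) (∈-++-range⁺ S a b) (cpEqB⁻ σ _ eqB)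

  ∈-cpList⁺ : ∀ {m S a b σ} → IsPerm m σ → HasPeakSet σ (S ∪[ a , b ]) → σ ∈ cpList m (S ++ range a b)
  ∈-cpList⁺ {m} {S} {a} {b} {σ} perm peaks = ∈-filter⁺ (λ σ → T? (cpEqB σ (S ++ range a b))) (∈-perms⁺ m σ perm)
    (cpEqB⁺ σ _ (HasPeakSet-cong σ (∈-++-range⁺ S a b) (∈-++-range⁻ S a b) peaks))

<ᵇ-true : ∀ {a b} → a < b → (a <ᵇ b) ≡ true
<ᵇ-true a<b = Equivalence.to T-≡ (<⇒<ᵇ a<b)

<ᵇ-false : ∀ {a b} → ¬ a < b → (a <ᵇ b) ≡ false
<ᵇ-false {a} {b} a≮b with a <ᵇ b in eq
... | true  = ⊥-elim (a≮b (<ᵇ⇒< a b (Equivalence.from T-≡ eq)))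
... | false = refl

peakAt : ℕ → ℕ → List ℕ → List ℕ
peakAt a x []      = []
peakAt a x (c ∷ _) = if (a <ᵇ x) ∧ (c <ᵇ x) then x ∷ [] else []

peaks-∷ : ∀ a x xs → peaks (a ∷ x ∷ xs) ≡ peakAt a x xs ++ peaks (x ∷ xs)
peaks-∷ a x []      = refl
peaks-∷ a x (c ∷ r) with (a <ᵇ x) ∧ (c <ᵇ x)
... | true  = refl
... | false = refl

peaks-∷-desc : ∀ {a b} r → b < a → peaks (a ∷ b ∷ r) ≡ peaks (b ∷ r)
peaks-∷-desc []      _   = refl
peaks-∷-desc (c ∷ r) b<a rewrite <ᵇ-false (<⇒≯ b<a) = refl

peaks-∷-peak : ∀ {a b c} r → a < b → c < b → peaks (a ∷ b ∷ c ∷ r) ≡ b ∷ peaks (b ∷ c ∷ r)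
peaks-∷-peak r a<b c<b rewrite <ᵇ-true a<b | <ᵇ-true c<b = refl

peaks-∷-asc : ∀ {a b c} r → b < c → peaks (a ∷ b ∷ c ∷ r) ≡ peaks (b ∷ c ∷ r)
peaks-∷-asc {a} {b} r b<c rewrite <ᵇ-false (<⇒≯ b<c) with a <ᵇ b
... | true  = refl
... | false = refl

peakAt-++ : ∀ a x α r s → peakAt a x (α ++ r ∷ s) ≡ peakAt a x (α ++ r ∷ [])
peakAt-++ a x []      r s = refl
peakAt-++ a x (_ ∷ _) r s = refl

peaks-++ : ∀ α a b r → peaks (α ++ a ∷ b ∷ r) ≡ peaks (α ++ a ∷ b ∷ []) ++ peaks (a ∷ b ∷ r)
peaks-++ []          a b r = refl
peaks-++ (y ∷ [])    a b r = peaks-∷ y a (b ∷ r)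
peaks-++ (y ∷ z ∷ α) a b r = begin
  peaks (y ∷ z ∷ α ++ a ∷ b ∷ r)
    ≡⟨ peaks-∷ y z (α ++ a ∷ b ∷ r) ⟩
  peakAt y z (α ++ a ∷ b ∷ r) ++ peaks (z ∷ α ++ a ∷ b ∷ r)
    ≡⟨ cong₂ _++_ (peakAt-++ y z α a (b ∷ r)) (peaks-++ (z ∷ α) a b r) ⟩
  peakAt y z (α ++ a ∷ []) ++ peaks (z ∷ α ++ a ∷ b ∷ []) ++ peaks (a ∷ b ∷ r)
    ≡⟨ ++-assoc (peakAt y z (α ++ a ∷ [])) _ _ ⟨
  (peakAt y z (α ++ a ∷ []) ++ peaks (z ∷ α ++ a ∷ b ∷ [])) ++ peaks (a ∷ b ∷ r)
    ≡⟨ cong (λ p → (p ++ _) ++ _) (peakAt-++ y z α a (b ∷ [])) ⟨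
  (peakAt y z (α ++ a ∷ b ∷ []) ++ peaks (z ∷ α ++ a ∷ b ∷ [])) ++ peaks (a ∷ b ∷ r)
    ≡⟨ cong (_++ peaks (a ∷ b ∷ r)) (peaks-∷ y z (α ++ a ∷ b ∷ [])) ⟨
  peaks (y ∷ z ∷ α ++ a ∷ b ∷ []) ++ peaks (a ∷ b ∷ r) ∎
  where open ≡-Reasoning

peaks-∷ʳ-asc : ∀ xs {y z} → y < z → peaks (xs ++ y ∷ z ∷ []) ≡ peaks (xs ++ y ∷ [])
peaks-∷ʳ-asc []           _   = refl
peaks-∷ʳ-asc (w ∷ [])     {y} y<z rewrite <ᵇ-false (<⇒≯ y<z) with w <ᵇ y
... | true  = refl
... | false = refl
peaks-∷ʳ-asc (w ∷ u ∷ xs) {y} {z} y<z = begin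
  peaks (w ∷ u ∷ xs ++ y ∷ z ∷ [])
    ≡⟨ peaks-∷ w u (xs ++ y ∷ z ∷ []) ⟩
  peakAt w u (xs ++ y ∷ z ∷ []) ++ peaks (u ∷ xs ++ y ∷ z ∷ [])
    ≡⟨ cong₂ _++_ (peakAt-++ w u xs y (z ∷ [])) (peaks-∷ʳ-asc (u ∷ xs) y<z) ⟩
  peakAt w u (xs ++ y ∷ []) ++ peaks (u ∷ xs ++ y ∷ [])
    ≡⟨ peaks-∷ w u (xs ++ y ∷ []) ⟨
  peaks (w ∷ u ∷ xs ++ y ∷ []) ∎
  where open ≡-Reasoning

peaks-++-asc : ∀ α w m r → w < m → peaks (α ++ w ∷ m ∷ r) ≡ peaks (α ++ w ∷ []) ++ peaks (w ∷ m ∷ r)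
peaks-++-asc α w m r w<m = trans (peaks-++ α w m r) (cong (_++ peaks (w ∷ m ∷ r)) (peaks-∷ʳ-asc α w<m))

Peak : List ℕ → ℕ → Set
Peak σ x = ∃ λ α → ∃ λ a → ∃ λ c → ∃ λ β → σ ≡ α ++ a ∷ x ∷ c ∷ β × a < x × c < x

Peak-∷ : ∀ {σ x} a → Peak σ x → Peak (a ∷ σ) x
Peak-∷ a (α , a′ , c′ , β , refl , a′<x , c′<x) = a ∷ α , a′ , c′ , β , refl , a′<x , c′<x

∈-peaks⁻ : ∀ σ {x} → x ∈ peaks σ → Peak σ x
∈-peaks⁻ (a ∷ y ∷ c ∷ r) {x} p = split p (∈-peaks⁻ (y ∷ c ∷ r))
  where
  split : x ∈ peaks (a ∷ y ∷ c ∷ r) → (x ∈ peaks (y ∷ c ∷ r) → Peak (y ∷ c ∷ r) x) → Peak (a ∷ y ∷ c ∷ r) x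
  split p ih with (a <ᵇ y) ∧ (c <ᵇ y) in eq
  split (here refl) _ | true with Equivalence.to T-∧ (Equivalence.from T-≡ eq)
  ... | a<y , c<y = [] , a , c , r , refl , <ᵇ⇒< a y a<y , <ᵇ⇒< c y c<y
  split (there q)  ih | true  = Peak-∷ a (ih q)
  split q          ih | false = Peak-∷ a (ih q)

∈-peaks⁺ : ∀ α {a x c} β → a < x → c < x → x ∈ peaks (α ++ a ∷ x ∷ c ∷ β)
∈-peaks⁺ α {a} {x} {c} β a<x c<x rewrite peaks-++ α a x (c ∷ β) | peaks-∷-peak β a<x c<x =
  ∈-++⁺ʳ (peaks (α ++ a ∷ x ∷ [])) (here refl)

peaks⊆ : ∀ σ {x} → x ∈ peaks σ → x ∈ σ
peaks⊆ σ p with ∈-peaks⁻ σ p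
... | α , a , c , β , refl , _ = ∈-++⁺ʳ α (there (here refl))

peak-neighbours : ∀ σ x α β → Unique σ → x ∈ peaks σ → σ ≡ α ++ x ∷ β →
  ∃ λ α′ → ∃ λ a → ∃ λ c → ∃ λ β′ → α ≡ α′ ∷ʳ a × β ≡ c ∷ β′ × a < x × c < x
peak-neighbours σ x α β u p refl with ∈-peaks⁻ σ p
... | γ , a , c , δ , eq , a<x , c<x
  with ++-∷-cancel α β (γ ++ a ∷ []) (c ∷ δ) (x∉ α β u) (x∉ (γ ++ a ∷ []) (c ∷ δ) u′)
         (trans eq (sym (++-assoc γ (a ∷ []) _)))
  where
  x∉ : ∀ α β → Unique (α ++ x ∷ β) → x ∉ α
  x∉ α β u q = Unique-∉-split α u (∈-++⁺ˡ q)
  u′ : Unique ((γ ++ a ∷ []) ++ x ∷ c ∷ δ)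
  u′ = subst Unique (trans eq (sym (++-assoc γ (a ∷ []) _))) u
... | refl , refl = γ , a , c , δ , refl , refl , a<x , c<x

module _ (f : ℕ → ℕ) (f-mono : ∀ {a b} → a < b → f a < f b) where

  private
    f-<ᵇ : ∀ a b → (f a <ᵇ f b) ≡ (a <ᵇ b)
    f-<ᵇ a b with a <? b
    ... | yes a<b = trans (<ᵇ-true (f-mono a<b)) (sym (<ᵇ-true a<b))
    ... | no  a≮b = trans (<ᵇ-false (λ fa<fb → fb≮fa (≮⇒≥ a≮b) fa<fb)) (sym (<ᵇ-false a≮b))
      where
      fb≮fa : b ≤ a → f a < f b → ⊥
      fb≮fa b≤a fa<fb with m≤n⇒m<n∨m≡n b≤a
      ... | inj₁ b<a  = <-asym fa<fb (f-mono b<a)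
      ... | inj₂ refl = <-irrefl refl fa<fb

    peakAt-map : ∀ a y xs → map f (peakAt a y xs) ≡ peakAt (f a) (f y) (map f xs)
    peakAt-map a y []      = refl
    peakAt-map a y (c ∷ r) rewrite f-<ᵇ a y | f-<ᵇ c y with (a <ᵇ y) ∧ (c <ᵇ y)
    ... | true  = refl
    ... | false = refl

  peaks-map : ∀ σ → peaks (map f σ) ≡ map f (peaks σ)
  peaks-map []           = refl
  peaks-map (a ∷ [])     = refl
  peaks-map (a ∷ y ∷ xs) = begin
    peaks (f a ∷ f y ∷ map f xs)                            ≡⟨ peaks-∷ (f a) (f y) (map f xs) ⟩
    peakAt (f a) (f y) (map f xs) ++ peaks (map f (y ∷ xs)) ≡⟨ cong₂ _++_ (peakAt-map a y xs) (sym (peaks-map (y ∷ xs))) ⟨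
    map f (peakAt a y xs) ++ map f (peaks (y ∷ xs))         ≡⟨ map-++ f (peakAt a y xs) _ ⟨
    map f (peakAt a y xs ++ peaks (y ∷ xs))                 ≡⟨ cong (map f) (peaks-∷ a y xs) ⟨
    map f (peaks (a ∷ y ∷ xs))                              ∎
    where open ≡-Reasoning

punchIn : ℕ → ℕ → ℕ
punchIn v x = if x <ᵇ v then x else suc x

punchOut : ℕ → ℕ → ℕ
punchOut v x = if x <ᵇ v then x else pred x

punchIn-< : ∀ {v x} → x < v → punchIn v x ≡ x
punchIn-< x<v rewrite <ᵇ-true x<v = refl

punchIn-≥ : ∀ {v x} → v ≤ x → punchIn v x ≡ suc x
punchIn-≥ v≤x rewrite <ᵇ-false (≤⇒≯ v≤x) = refl

punchOut-< : ∀ {v x} → x < v → punchOut v x ≡ x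
punchOut-< x<v rewrite <ᵇ-true x<v = refl

punchOut-≥ : ∀ {v x} → v ≤ x → punchOut v x ≡ pred x
punchOut-≥ v≤x rewrite <ᵇ-false (≤⇒≯ v≤x) = refl

punchOut-punchIn : ∀ v x → punchOut v (punchIn v x) ≡ x
punchOut-punchIn v x with x <? v
... | yes x<v = trans (cong (punchOut v) (punchIn-< x<v)) (punchOut-< x<v)
... | no  x≮v = trans (cong (punchOut v) (punchIn-≥ (≮⇒≥ x≮v))) (punchOut-≥ (m≤n⇒m≤1+n (≮⇒≥ x≮v)))

punchIn-punchOut : ∀ v {y} → y ≢ v → punchIn v (punchOut v y) ≡ y
punchIn-punchOut v {y} y≢v with y <? v
... | yes y<v = trans (cong (punchIn v) (punchOut-< y<v)) (punchIn-< y<v)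
... | no  y≮v = trans (cong (punchIn v) (punchOut-≥ (≮⇒≥ y≮v))) (above y (≤∧≢⇒< (≮⇒≥ y≮v) (y≢v ∘ sym)))
  where
  above : ∀ y → v < y → punchIn v (pred y) ≡ y
  above (suc y) (s≤s v≤y) = punchIn-≥ v≤y

punchIn-injective : ∀ v {a b} → punchIn v a ≡ punchIn v b → a ≡ b
punchIn-injective v {a} {b} e =
  trans (sym (punchOut-punchIn v a)) (trans (cong (punchOut v) e) (punchOut-punchIn v b))

punchIn-mono-< : ∀ v {a b} → a < b → punchIn v a < punchIn v b
punchIn-mono-< v {a} {b} a<b with a <? v | b <? v
... | yes a<v | yes b<v rewrite punchIn-< a<v | punchIn-< b<v = a<b
... | yes a<v | no  b≮v rewrite punchIn-< a<v | punchIn-≥ (≮⇒≥ b≮v) = m<n⇒m<1+n a<b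
... | no  a≮v | yes b<v = ⊥-elim (a≮v (<-trans a<b b<v))
... | no  a≮v | no  b≮v rewrite punchIn-≥ (≮⇒≥ a≮v) | punchIn-≥ (≮⇒≥ b≮v) = s≤s a<b

punchIn≢ : ∀ v x → punchIn v x ≢ v
punchIn≢ v x e with x <? v
... | yes x<v = <-irrefl (trans (sym (punchIn-< x<v)) e) x<v
... | no  x≮v = <-irrefl (sym e) (subst (v <_) (sym (punchIn-≥ (≮⇒≥ x≮v))) (s≤s (≮⇒≥ x≮v)))

punchIn-above : ∀ v {x} → v ≤ x → v < punchIn v x
punchIn-above v v≤x rewrite punchIn-≥ v≤x = s≤s v≤x

n≤punchIn : ∀ v x → x ≤ punchIn v x
n≤punchIn v x with x <? v
... | yes x<v rewrite punchIn-< x<v = ≤-refl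
... | no  x≮v rewrite punchIn-≥ (≮⇒≥ x≮v) = n≤1+n x

punchIn≤suc : ∀ v x → punchIn v x ≤ suc x
punchIn≤suc v x with x <? v
... | yes x<v rewrite punchIn-< x<v = n≤1+n x
... | no  x≮v rewrite punchIn-≥ (≮⇒≥ x≮v) = ≤-refl

punchIn-∈[1,] : ∀ v {m y} → y ∈[1, m ] → punchIn v y ∈[1, suc m ]
punchIn-∈[1,] v {y = y} (1≤y , y≤m) = ≤-trans 1≤y (n≤punchIn v y) , ≤-trans (punchIn≤suc v y) (s≤s y≤m)

punchIn-∈[1,]⁻ : ∀ {v m y} → 1 ≤ v → v ≤ suc m → punchIn v y ∈[1, suc m ] → y ∈[1, m ]
punchIn-∈[1,]⁻ {v} {m} {y} 1≤v v≤sm (1≤ , ≤sm) with y <? v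
... | yes y<v rewrite punchIn-< y<v = 1≤ , ≤-pred (<-≤-trans y<v v≤sm)
... | no  y≮v rewrite punchIn-≥ (≮⇒≥ y≮v) = ≤-trans 1≤v (≮⇒≥ y≮v) , ≤-pred ≤sm

peaks-punchIn : ∀ v σ → peaks (map (punchIn v) σ) ≡ map (punchIn v) (peaks σ)
peaks-punchIn v = peaks-map (punchIn v) (punchIn-mono-< v)

map-punchIn-punchOut : ∀ v ρ → v ∉ ρ → map (punchIn v) (map (punchOut v) ρ) ≡ ρ
map-punchIn-punchOut v []      _  = refl
map-punchIn-punchOut v (y ∷ ρ) v∉ =
  cong₂ _∷_ (punchIn-punchOut v (λ e → v∉ (here (sym e)))) (map-punchIn-punchOut v ρ (v∉ ∘ there))

∉-map-punchIn : ∀ v τ → v ∉ map (punchIn v) τ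
∉-map-punchIn v τ p with ∈-map⁻ (punchIn v) p
... | x , _ , e = punchIn≢ v x (sym e)

-- insertions₁ v ρ lists the ways to insert v into ρ without changing its peaks, insertions₂ v t ρ
-- the ways to insert v followed by a new peak t.
insertNextToLarger : ℕ → List ℕ → List (List ℕ)
insertNextToLarger v []       = []
insertNextToLarger v (x ∷ xs) with v <? x
... | yes _ = (v ∷ x ∷ xs) ∷ (x ∷ v ∷ xs) ∷ map (x ∷_) (insertNextToLarger v xs)
... | no  _ = map (x ∷_) (insertNextToLarger v xs)

insertAfterLarger : ℕ → ℕ → List ℕ → List (List ℕ)
insertAfterLarger v t []       = []
insertAfterLarger v t (x ∷ xs) with v <? x
... | yes _ = (x ∷ v ∷ t ∷ xs) ∷ map (x ∷_) (insertAfterLarger v t xs)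
... | no  _ = map (x ∷_) (insertAfterLarger v t xs)

insertions₁ : ℕ → List ℕ → List (List ℕ)
insertions₁ v ρ = (v ∷ ρ) ∷ (ρ ++ v ∷ []) ∷ insertNextToLarger v ρ

insertions₂ : ℕ → ℕ → List ℕ → List (List ℕ)
insertions₂ v t ρ = (v ∷ t ∷ ρ) ∷ (ρ ++ t ∷ v ∷ []) ∷ insertAfterLarger v t ρ

countAbove : ℕ → List ℕ → ℕ
countAbove v xs = length (filter (v <?_) xs)

length-insertNextToLarger : ∀ v ρ → length (insertNextToLarger v ρ) ≡ 2 * countAbove v ρ
length-insertNextToLarger v []       = refl
length-insertNextToLarger v (x ∷ xs) with v <? x
... | yes v<x = begin
  suc (suc (length (map (x ∷_) (insertNextToLarger v xs)))) ≡⟨ cong (suc ∘ suc) (length-map (x ∷_) (insertNextToLarger v xs)) ⟩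
  suc (suc (length (insertNextToLarger v xs)))              ≡⟨ cong (suc ∘ suc) (length-insertNextToLarger v xs) ⟩
  2 + 2 * countAbove v xs                                   ≡⟨ *-suc 2 (countAbove v xs) ⟨
  2 * length (x ∷ filter (v <?_) xs)                        ≡⟨ cong (λ l → 2 * length l) (filter-accept (v <?_) {xs = xs} v<x) ⟨
  2 * countAbove v (x ∷ xs)                                 ∎
  where open ≡-Reasoning
... | no  v≮x = begin
  length (map (x ∷_) (insertNextToLarger v xs)) ≡⟨ length-map (x ∷_) (insertNextToLarger v xs) ⟩
  length (insertNextToLarger v xs)              ≡⟨ length-insertNextToLarger v xs ⟩
  2 * countAbove v xs                           ≡⟨ cong (λ l → 2 * length l) (filter-reject (v <?_) {xs = xs} v≮x) ⟨
  2 * countAbove v (x ∷ xs)                     ∎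
  where open ≡-Reasoning

length-insertAfterLarger : ∀ v t ρ → length (insertAfterLarger v t ρ) ≡ countAbove v ρ
length-insertAfterLarger v t []       = refl
length-insertAfterLarger v t (x ∷ xs) with v <? x
... | yes v<x = begin
  suc (length (map (x ∷_) (insertAfterLarger v t xs))) ≡⟨ cong suc (length-map (x ∷_) (insertAfterLarger v t xs)) ⟩
  suc (length (insertAfterLarger v t xs))              ≡⟨ cong suc (length-insertAfterLarger v t xs) ⟩
  length (x ∷ filter (v <?_) xs)                       ≡⟨ cong length (filter-accept (v <?_) {xs = xs} v<x) ⟨
  countAbove v (x ∷ xs)                                ∎
  where open ≡-Reasoning
... | no  v≮x = begin
  length (map (x ∷_) (insertAfterLarger v t xs)) ≡⟨ length-map (x ∷_) (insertAfterLarger v t xs) ⟩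
  length (insertAfterLarger v t xs)              ≡⟨ length-insertAfterLarger v t xs ⟩
  countAbove v xs                                ≡⟨ cong length (filter-reject (v <?_) {xs = xs} v≮x) ⟨
  countAbove v (x ∷ xs)                          ∎
  where open ≡-Reasoning

length-insertions₁ : ∀ v ρ → length (insertions₁ v ρ) ≡ 2 + 2 * countAbove v ρ
length-insertions₁ v ρ = cong (suc ∘ suc) (length-insertNextToLarger v ρ)

length-insertions₂ : ∀ v t ρ → length (insertions₂ v t ρ) ≡ 2 + countAbove v ρ
length-insertions₂ v t ρ = cong (suc ∘ suc) (length-insertAfterLarger v t ρ)

NextToLargerForm : ℕ → List ℕ → List ℕ → Set
NextToLargerForm v ρ σ = ∃ λ α → ∃ λ x → ∃ λ β → ρ ≡ α ++ x ∷ β × v < x ×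
  (σ ≡ α ++ v ∷ x ∷ β ⊎ σ ≡ α ++ x ∷ v ∷ β)

NextToLargerForm-∷ : ∀ {v ρ σ} x → NextToLargerForm v ρ σ → NextToLargerForm v (x ∷ ρ) (x ∷ σ)
NextToLargerForm-∷ x (α , y , β , refl , v<y , inj₁ refl) = x ∷ α , y , β , refl , v<y , inj₁ refl
NextToLargerForm-∷ x (α , y , β , refl , v<y , inj₂ refl) = x ∷ α , y , β , refl , v<y , inj₂ refl

∈-insertNextToLarger⁻ : ∀ v ρ {σ} → σ ∈ insertNextToLarger v ρ → NextToLargerForm v ρ σ
∈-insertNextToLarger⁻ v (x ∷ xs) p with v <? x
∈-insertNextToLarger⁻ v (x ∷ xs) (here refl)         | yes v<x = [] , x , xs , refl , v<x , inj₁ refl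
∈-insertNextToLarger⁻ v (x ∷ xs) (there (here refl)) | yes v<x = [] , x , xs , refl , v<x , inj₂ refl
∈-insertNextToLarger⁻ v (x ∷ xs) (there (there p))   | yes _ with ∈-map⁻ (x ∷_) p
... | _ , q , refl = NextToLargerForm-∷ x (∈-insertNextToLarger⁻ v xs q)
∈-insertNextToLarger⁻ v (x ∷ xs) p                   | no  _ with ∈-map⁻ (x ∷_) p
... | _ , q , refl = NextToLargerForm-∷ x (∈-insertNextToLarger⁻ v xs q)

∈-insertNextToLarger⁺ : ∀ v α {x} β → v < x →
  (α ++ v ∷ x ∷ β) ∈ insertNextToLarger v (α ++ x ∷ β) × (α ++ x ∷ v ∷ β) ∈ insertNextToLarger v (α ++ x ∷ β)
∈-insertNextToLarger⁺ v []      {x} β v<x with v <? x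
... | yes _   = here refl , there (here refl)
... | no  v≮x = ⊥-elim (v≮x v<x)
∈-insertNextToLarger⁺ v (a ∷ α) β v<x with v <? a | ∈-insertNextToLarger⁺ v α β v<x
... | yes _ | p , q = there (there (∈-map⁺ (a ∷_) p)) , there (there (∈-map⁺ (a ∷_) q))
... | no  _ | p , q = ∈-map⁺ (a ∷_) p , ∈-map⁺ (a ∷_) q

AfterLargerForm : ℕ → ℕ → List ℕ → List ℕ → Set
AfterLargerForm v t ρ σ = ∃ λ α → ∃ λ x → ∃ λ β → ρ ≡ α ++ x ∷ β × v < x × σ ≡ α ++ x ∷ v ∷ t ∷ β

∈-insertAfterLarger⁻ : ∀ v t ρ {σ} → σ ∈ insertAfterLarger v t ρ → AfterLargerForm v t ρ σ
∈-insertAfterLarger⁻ v t (x ∷ xs) p with v <? x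
∈-insertAfterLarger⁻ v t (x ∷ xs) (here refl) | yes v<x = [] , x , xs , refl , v<x , refl
∈-insertAfterLarger⁻ v t (x ∷ xs) (there p)   | yes _ with ∈-map⁻ (x ∷_) p
... | _ , q , refl with ∈-insertAfterLarger⁻ v t xs q
... | α , y , β , refl , v<y , refl = x ∷ α , y , β , refl , v<y , refl
∈-insertAfterLarger⁻ v t (x ∷ xs) p           | no  _ with ∈-map⁻ (x ∷_) p
... | _ , q , refl with ∈-insertAfterLarger⁻ v t xs q
... | α , y , β , refl , v<y , refl = x ∷ α , y , β , refl , v<y , refl

∈-insertAfterLarger⁺ : ∀ v t α {x} β → v < x → (α ++ x ∷ v ∷ t ∷ β) ∈ insertAfterLarger v t (α ++ x ∷ β)
∈-insertAfterLarger⁺ v t []      {x} β v<x with v <? x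
... | yes _   = here refl
... | no  v≮x = ⊥-elim (v≮x v<x)
∈-insertAfterLarger⁺ v t (a ∷ α) β v<x with v <? a
... | yes _ = there (∈-map⁺ (a ∷_) (∈-insertAfterLarger⁺ v t α β v<x))
... | no  _ = ∈-map⁺ (a ∷_) (∈-insertAfterLarger⁺ v t α β v<x)

∈-insertions₁⁻ : ∀ v ρ {σ} → σ ∈ insertions₁ v ρ → ∃ λ α → ∃ λ β → ρ ≡ α ++ β × σ ≡ α ++ v ∷ β
∈-insertions₁⁻ v ρ (here refl)         = [] , ρ , refl , refl
∈-insertions₁⁻ v ρ (there (here refl)) = ρ , [] , sym (++-identityʳ ρ) , refl
∈-insertions₁⁻ v ρ (there (there p)) with ∈-insertNextToLarger⁻ v ρ p
... | α , x , β , refl , _ , inj₁ refl = α , x ∷ β , refl , refl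
... | α , x , β , refl , _ , inj₂ refl =
  α ++ x ∷ [] , β , sym (++-assoc α (x ∷ []) β) , sym (++-assoc α (x ∷ []) (v ∷ β))

PairInsertion : ∀ {A : Set} → List A → List A → A → A → List A → Set
PairInsertion α β x y σ = σ ≡ α ++ x ∷ y ∷ β ⊎ (σ ≡ α ++ y ∷ x ∷ [] × β ≡ [])

∈-insertions₂⁻ : ∀ v t ρ {σ} → σ ∈ insertions₂ v t ρ → ∃ λ α → ∃ λ β → ρ ≡ α ++ β × PairInsertion α β v t σ
∈-insertions₂⁻ v t ρ (here refl)         = [] , ρ , refl , inj₁ refl
∈-insertions₂⁻ v t ρ (there (here refl)) = ρ , [] , sym (++-identityʳ ρ) , inj₂ (refl , refl)
∈-insertions₂⁻ v t ρ (there (there p)) with ∈-insertAfterLarger⁻ v t ρ p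
... | α , x , β , refl , _ , refl =
  α ++ x ∷ [] , β , sym (++-assoc α (x ∷ []) β) , inj₁ (sym (++-assoc α (x ∷ []) (v ∷ t ∷ β)))

NoAdjacentAbove : ℕ → List ℕ → Set
NoAdjacentAbove v ρ = ∀ α x y β → ρ ≡ α ++ x ∷ y ∷ β → v < x → v < y → ⊥

IsolatedAbove : ℕ → List ℕ → Set
IsolatedAbove v ρ = ∀ α x β → ρ ≡ α ++ x ∷ β → v < x →
  ∃ λ α′ → ∃ λ w → ∃ λ y → ∃ λ β′ → α ≡ α′ ∷ʳ w × β ≡ y ∷ β′ × ¬ v < w × ¬ v < y

module _ {v ρ} (isolated : IsolatedAbove v ρ) where

  IsolatedAbove⇒NoAdjacentAbove : NoAdjacentAbove v ρ
  IsolatedAbove⇒NoAdjacentAbove α x y β eq v<x v<y with isolated α x (y ∷ β) eq v<x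
  ... | _ , _ , _ , _ , _ , refl , _ , v≮y = v≮y v<y

  IsolatedAbove-head : ∀ {x β} → ρ ≡ x ∷ β → ¬ v < x
  IsolatedAbove-head eq v<x with isolated [] _ _ eq v<x
  ... | []    , _ , _ , _ , () , _
  ... | _ ∷ _ , _ , _ , _ , () , _

  IsolatedAbove-last : ∀ {α x} → ρ ≡ α ++ x ∷ [] → ¬ v < x
  IsolatedAbove-last eq v<x with isolated _ _ [] eq v<x
  ... | _ , _ , _ , _ , _ , () , _

head-of-insertNextToLarger : ∀ {v ρ} → v ∉ ρ → (v ∷ ρ) ∈ insertNextToLarger v ρ →
  ∃ λ y → ∃ λ β → ρ ≡ y ∷ β × v < y
head-of-insertNextToLarger {v} {ρ} v∉ p with ∈-insertNextToLarger⁻ v ρ p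
... | α , y , β , refl , v<y , inj₁ eq
  with ++-∷-cancel [] _ α (y ∷ β) (λ ()) (v∉ ∘ ∈-++⁺ˡ) eq
...   | refl , _ = y , β , refl , v<y
head-of-insertNextToLarger {v} {ρ} v∉ p | α , y , β , refl , _ , inj₂ eq
  with ++-∷-cancel [] _ (α ++ y ∷ []) β (λ ()) (v∉ ∘ ∈-∷ʳ-extend α β) (trans eq (sym (++-assoc α (y ∷ []) _)))
... | []≡α∷ʳy , _ = ⊥-elim ([]≢∷ʳ α []≡α∷ʳy)

last-of-insertNextToLarger : ∀ {v ρ} → v ∉ ρ → (ρ ++ v ∷ []) ∈ insertNextToLarger v ρ →
  ∃ λ α → ∃ λ y → ρ ≡ α ++ y ∷ [] × v < y
last-of-insertNextToLarger {v} {ρ} v∉ p with ∈-insertNextToLarger⁻ v ρ p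
... | α , y , β , refl , _ , inj₁ eq
  with ++-∷-cancel (α ++ y ∷ β) [] α (y ∷ β) v∉ (v∉ ∘ ∈-++⁺ˡ) eq
...   | _ , ()
last-of-insertNextToLarger {v} {ρ} v∉ p | α , y , β , refl , v<y , inj₂ eq
  with ++-∷-cancel (α ++ y ∷ β) [] (α ++ y ∷ []) β v∉ (v∉ ∘ ∈-∷ʳ-extend α β) (trans eq (sym (++-assoc α (y ∷ []) _)))
... | _ , refl = α , y , refl , v<y

Unique-insertNextToLarger : ∀ v ρ → v ∉ ρ → NoAdjacentAbove v ρ → Unique (insertNextToLarger v ρ)
Unique-insertNextToLarger v []       _  _     = []
Unique-insertNextToLarger v (x ∷ xs) v∉ noAdj with v <? x
... | yes v<x = ¬Any⇒All¬ _ first∉ ∷ ¬Any⇒All¬ _ second∉ ∷ rest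
  where
  rest : Unique (map (x ∷_) (insertNextToLarger v xs))
  rest = map⁺ ∷-injectiveʳ (Unique-insertNextToLarger v xs (v∉ ∘ there)
           λ α a b β eq → noAdj (x ∷ α) a b β (cong (x ∷_) eq))
  first∉ : (v ∷ x ∷ xs) ∉ (x ∷ v ∷ xs) ∷ map (x ∷_) (insertNextToLarger v xs)
  first∉ (here eq) = v∉ (here (∷-injectiveˡ eq))
  first∉ (there p) with ∈-map⁻ (x ∷_) p
  ... | _ , _ , eq = v∉ (here (∷-injectiveˡ eq))
  second∉ : (x ∷ v ∷ xs) ∉ map (x ∷_) (insertNextToLarger v xs)
  second∉ p with ∈-map⁻ (x ∷_) p
  ... | _ , q , refl with head-of-insertNextToLarger (v∉ ∘ there) q
  ... | y , β , refl , v<y = noAdj [] x y β refl v<x v<y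
... | no _ = map⁺ ∷-injectiveʳ (Unique-insertNextToLarger v xs (v∉ ∘ there)
               λ α a b β eq → noAdj (x ∷ α) a b β (cong (x ∷_) eq))

Unique-insertions₁ : ∀ v ρ → v ∉ ρ → ρ ≢ [] → IsolatedAbove v ρ → Unique (insertions₁ v ρ)
Unique-insertions₁ v ρ v∉ ρ≢[] isolated =
  ¬Any⇒All¬ _ front∉ ∷ ¬Any⇒All¬ _ back∉ ∷
  Unique-insertNextToLarger v ρ v∉ (IsolatedAbove⇒NoAdjacentAbove isolated)
  where
  front≢back : ∀ {ρ} → v ∉ ρ → ρ ≢ [] → v ∷ ρ ≢ ρ ++ v ∷ []
  front≢back {[]}    _  ρ≢[] _  = ρ≢[] refl
  front≢back {r ∷ _} v∉ _    eq = v∉ (here (∷-injectiveˡ eq))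
  front∉ : (v ∷ ρ) ∉ (ρ ++ v ∷ []) ∷ insertNextToLarger v ρ
  front∉ (here eq) = front≢back v∉ ρ≢[] eq
  front∉ (there p) with head-of-insertNextToLarger v∉ p
  ... | y , β , eq , v<y = IsolatedAbove-head isolated eq v<y
  back∉ : (ρ ++ v ∷ []) ∉ insertNextToLarger v ρ
  back∉ p with last-of-insertNextToLarger v∉ p
  ... | α , y , eq , v<y = IsolatedAbove-last isolated eq v<y

head-of-insertAfterLarger : ∀ {v t ρ σ} → (v ∷ σ) ∈ insertAfterLarger v t ρ → v ∈ ρ
head-of-insertAfterLarger {v} {t} {ρ} p with ∈-insertAfterLarger⁻ v t ρ p
... | []    , y , β , refl , _ , eq = here (∷-injectiveˡ eq)
... | a ∷ α , y , β , refl , _ , eq = here (∷-injectiveˡ eq)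

Unique-insertAfterLarger : ∀ v t ρ → v ∉ ρ → Unique (insertAfterLarger v t ρ)
Unique-insertAfterLarger v t []       _  = []
Unique-insertAfterLarger v t (x ∷ xs) v∉ with v <? x
... | yes _ = ¬Any⇒All¬ _ first∉ ∷ map⁺ ∷-injectiveʳ (Unique-insertAfterLarger v t xs (v∉ ∘ there))
  where
  first∉ : (x ∷ v ∷ t ∷ xs) ∉ map (x ∷_) (insertAfterLarger v t xs)
  first∉ p with ∈-map⁻ (x ∷_) p
  ... | _ , q , refl = v∉ (there (head-of-insertAfterLarger q))
... | no  _ = map⁺ ∷-injectiveʳ (Unique-insertAfterLarger v t xs (v∉ ∘ there))

Unique-insertions₂ : ∀ v t ρ → v ∉ ρ → v ≢ t → Unique (insertions₂ v t ρ)
Unique-insertions₂ v t ρ v∉ v≢t =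
  ¬Any⇒All¬ _ front∉ ∷ ¬Any⇒All¬ _ back∉ ∷ Unique-insertAfterLarger v t ρ v∉
  where
  front≢back : ∀ {ρ} → v ∉ ρ → v ∷ t ∷ ρ ≢ ρ ++ t ∷ v ∷ []
  front≢back {[]}    _  eq = v≢t (∷-injectiveˡ eq)
  front≢back {r ∷ _} v∉ eq = v∉ (here (∷-injectiveˡ eq))
  front∉ : (v ∷ t ∷ ρ) ∉ (ρ ++ t ∷ v ∷ []) ∷ insertAfterLarger v t ρ
  front∉ (here eq) = front≢back v∉ eq
  front∉ (there p) = v∉ (head-of-insertAfterLarger p)
  back∉ : (ρ ++ t ∷ v ∷ []) ∉ insertAfterLarger v t ρ
  back∉ p with ∈-insertAfterLarger⁻ v t ρ p
  ... | α , y , β , refl , _ , eq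
    with ++-∷-cancel (ρ ++ t ∷ []) [] (α ++ y ∷ []) (t ∷ β)
           (∉-++-∷ ρ [] v≢t (v∉ ∘ subst (v ∈_) (++-identityʳ ρ))) (v∉ ∘ ∈-∷ʳ-extend α β)
           (trans (++-assoc ρ (t ∷ []) (v ∷ [])) (trans eq (sym (++-assoc α (y ∷ []) (v ∷ t ∷ β)))))
  ... | _ , ()

-- Decoders: FlankedAbove separates insertions₁ from insertions₂, partner recovers t, remove recovers ρ.
before : ℕ → List ℕ → List ℕ
before v []       = []
before v (x ∷ xs) with x ≟ v
... | yes _ = []
... | no  _ = x ∷ before v xs

after : ℕ → List ℕ → List ℕ
after v []       = []
after v (x ∷ xs) with x ≟ v
... | yes _ = xs
... | no  _ = after v xs

before-insert : ∀ {v} α β → v ∉ α → before v (α ++ v ∷ β) ≡ α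
before-insert {v} []      β _ with v ≟ v
... | yes _   = refl
... | no  v≢v = ⊥-elim (v≢v refl)
before-insert {v} (x ∷ α) β v∉ with x ≟ v
... | yes refl = ⊥-elim (v∉ (here refl))
... | no  _    = cong (x ∷_) (before-insert α β (v∉ ∘ there))

after-insert : ∀ {v} α β → v ∉ α → after v (α ++ v ∷ β) ≡ β
after-insert {v} []      β _ with v ≟ v
... | yes _   = refl
... | no  v≢v = ⊥-elim (v≢v refl)
after-insert {v} (x ∷ α) β v∉ with x ≟ v
... | yes refl = ⊥-elim (v∉ (here refl))
... | no  _    = after-insert α β (v∉ ∘ there)

remove : ℕ → List ℕ → List ℕ
remove v σ = before v σ ++ after v σ

remove-insert : ∀ {v} α β → v ∉ α → remove v (α ++ v ∷ β) ≡ α ++ β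
remove-insert α β v∉ = cong₂ _++_ (before-insert α β v∉) (after-insert α β v∉)

FlankedAbove : ℕ → List ℕ → Set
FlankedAbove v σ = Maybe.All (v <_) (last (before v σ)) × Maybe.All (v <_) (head (after v σ))

partner : ℕ → List ℕ → ℕ
partner v σ = fromMaybe (fromMaybe 0 (last (before v σ))) (head (after v σ))

FlankedAbove-insert⁻ : ∀ {v} α β → v ∉ α → FlankedAbove v (α ++ v ∷ β) →
  Maybe.All (v <_) (last α) × Maybe.All (v <_) (head β)
FlankedAbove-insert⁻ α β v∉ rewrite before-insert α β v∉ | after-insert α β v∉ = id

FlankedAbove-insert⁺ : ∀ {v} α β → v ∉ α → Maybe.All (v <_) (last α) → Maybe.All (v <_) (head β) →
  FlankedAbove v (α ++ v ∷ β)
FlankedAbove-insert⁺ α β v∉ l h rewrite before-insert α β v∉ | after-insert α β v∉ = l , h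

partner-insert : ∀ {v} α β → v ∉ α → partner v (α ++ v ∷ β) ≡ fromMaybe (fromMaybe 0 (last α)) (head β)
partner-insert α β v∉ rewrite before-insert α β v∉ | after-insert α β v∉ = refl

¬FlankedAbove-insertions₁ : ∀ {v ρ σ} → v ∉ ρ → ρ ≢ [] → IsolatedAbove v ρ → σ ∈ insertions₁ v ρ →
  ¬ FlankedAbove v σ
¬FlankedAbove-insertions₁ {ρ = []}    _  ρ≢[] _ (here refl) _ = ρ≢[] refl
¬FlankedAbove-insertions₁ {ρ = r ∷ γ} _  _    isolated (here refl) flanked
  with FlankedAbove-insert⁻ [] (r ∷ γ) (λ ()) flanked
... | _ , just v<r = IsolatedAbove-head isolated refl v<r
¬FlankedAbove-insertions₁ {v} {ρ} v∉ ρ≢[] isolated (there (here refl)) flanked with initLast ρ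
... | []      = ρ≢[] refl
... | α ∷ʳ′ w with subst (Maybe.All (v <_)) (last-∷ʳ α) (proj₁ (FlankedAbove-insert⁻ (α ∷ʳ w) [] v∉ flanked))
...   | just v<w = IsolatedAbove-last isolated refl v<w
¬FlankedAbove-insertions₁ {v} {ρ} v∉ ρ≢[] isolated (there (there p)) flanked
  with ∈-insertNextToLarger⁻ v ρ p
... | α , x , β , refl , v<x , form with isolated α x β refl v<x
...   | α′ , w , y , β′ , refl , refl , v≮w , v≮y with form
...     | inj₁ refl
  with subst (Maybe.All (v <_)) (last-∷ʳ α′) (proj₁ (FlankedAbove-insert⁻ (α′ ∷ʳ w) _ (v∉ ∘ ∈-++⁺ˡ) flanked))
...       | just v<w = v≮w v<w
¬FlankedAbove-insertions₁ {v} {ρ} v∉ ρ≢[] isolated (there (there p)) flanked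
  | α , x , β , refl , v<x , form | α′ , w , y , β′ , refl , refl , v≮w , v≮y | inj₂ refl
  with proj₂ (FlankedAbove-insert⁻ ((α′ ∷ʳ w) ∷ʳ x) (y ∷ β′) (v∉ ∘ ∈-∷ʳ-extend (α′ ∷ʳ w) (y ∷ β′))
                (subst (FlankedAbove v) (sym (++-assoc (α′ ∷ʳ w) (x ∷ []) (v ∷ y ∷ β′))) flanked))
... | just v<y = v≮y v<y

FlankedAbove-insertions₂ : ∀ {v t ρ σ} → v < t → v ∉ ρ → σ ∈ insertions₂ v t ρ → FlankedAbove v σ
FlankedAbove-insertions₂ v<t v∉ (here refl) = FlankedAbove-insert⁺ [] _ (λ ()) nothing (just v<t)
FlankedAbove-insertions₂ {v} {t} {ρ} v<t v∉ (there (here refl)) =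
  subst (FlankedAbove v) (++-assoc ρ (t ∷ []) (v ∷ []))
    (FlankedAbove-insert⁺ (ρ ∷ʳ t) [] (∉-++-∷ ρ [] (<⇒≢ v<t) (v∉ ∘ subst (v ∈_) (++-identityʳ ρ)))
      (subst (Maybe.All (v <_)) (sym (last-∷ʳ ρ)) (just v<t)) nothing)
FlankedAbove-insertions₂ {v} {t} {ρ} v<t v∉ (there (there p)) with ∈-insertAfterLarger⁻ v t ρ p
... | α , x , β , refl , v<x , refl =
  subst (FlankedAbove v) (++-assoc α (x ∷ []) (v ∷ t ∷ β))
    (FlankedAbove-insert⁺ (α ∷ʳ x) (t ∷ β) (v∉ ∘ ∈-∷ʳ-extend α β)
      (subst (Maybe.All (v <_)) (sym (last-∷ʳ α)) (just v<x)) (just v<t))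

partner-insertions₂ : ∀ {v t ρ σ} → v < t → v ∉ ρ → σ ∈ insertions₂ v t ρ → partner v σ ≡ t
partner-insertions₂ {v} {t} {ρ} v<t v∉ p with ∈-insertions₂⁻ v t ρ p
... | α , β , refl , inj₁ refl = partner-insert α (t ∷ β) (v∉ ∘ ∈-++⁺ˡ)
... | α , β , refl , inj₂ (refl , refl) = begin
  partner v (α ++ t ∷ v ∷ [])               ≡⟨ cong (partner v) (++-assoc α (t ∷ []) (v ∷ [])) ⟨
  partner v ((α ∷ʳ t) ++ v ∷ [])            ≡⟨ partner-insert (α ∷ʳ t) [] (∉-++-∷ α [] (<⇒≢ v<t) v∉) ⟩
  fromMaybe 0 (last (α ∷ʳ t))               ≡⟨ cong (fromMaybe 0) (last-∷ʳ α) ⟩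
  t                                         ∎
  where open ≡-Reasoning

remove-insertions₁ : ∀ {v ρ σ} → v ∉ ρ → σ ∈ insertions₁ v ρ → remove v σ ≡ ρ
remove-insertions₁ {v} {ρ} v∉ p with ∈-insertions₁⁻ v ρ p
... | α , β , refl , refl = remove-insert α β (v∉ ∘ ∈-++⁺ˡ)

remove-insertions₂ : ∀ {v t ρ σ} → v < t → v ∉ ρ → t ∉ ρ → σ ∈ insertions₂ v t ρ → remove t (remove v σ) ≡ ρ
remove-insertions₂ {v} {t} {ρ} v<t v∉ t∉ p with ∈-insertions₂⁻ v t ρ p
... | α , β , refl , inj₁ refl = begin
  remove t (remove v (α ++ v ∷ t ∷ β))      ≡⟨ cong (remove t) (remove-insert α (t ∷ β) (v∉ ∘ ∈-++⁺ˡ)) ⟩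
  remove t (α ++ t ∷ β)                     ≡⟨ remove-insert α β (t∉ ∘ ∈-++⁺ˡ) ⟩
  α ++ β                                    ∎
  where open ≡-Reasoning
... | α , β , refl , inj₂ (refl , refl) = begin
  remove t (remove v (α ++ t ∷ v ∷ []))     ≡⟨ cong (remove t ∘ remove v) (++-assoc α (t ∷ []) (v ∷ [])) ⟨
  remove t (remove v ((α ∷ʳ t) ++ v ∷ []))  ≡⟨ cong (remove t) (remove-insert (α ∷ʳ t) [] (∉-++-∷ α [] (<⇒≢ v<t) v∉)) ⟩
  remove t ((α ∷ʳ t) ++ [])                 ≡⟨ cong (remove t) (++-identityʳ (α ∷ʳ t)) ⟩
  remove t (α ++ t ∷ [])                    ≡⟨ remove-insert α [] (t∉ ∘ ∈-++⁺ˡ) ⟩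
  α ++ []                                   ∎
  where open ≡-Reasoning

peaks-hill : ∀ α w x y β → w < x → y < x →
  peaks ((α ∷ʳ w) ++ x ∷ y ∷ β) ≡ peaks (α ∷ʳ w) ++ x ∷ peaks (y ∷ β)
peaks-hill α w x y β w<x y<x = begin
  peaks ((α ∷ʳ w) ++ x ∷ y ∷ β)               ≡⟨ cong peaks (++-assoc α (w ∷ []) (x ∷ y ∷ β)) ⟩
  peaks (α ++ w ∷ x ∷ y ∷ β)                  ≡⟨ peaks-++-asc α w x (y ∷ β) w<x ⟩
  peaks (α ∷ʳ w) ++ peaks (w ∷ x ∷ y ∷ β)     ≡⟨ cong (peaks (α ∷ʳ w) ++_) (peaks-∷-peak β w<x y<x) ⟩
  peaks (α ∷ʳ w) ++ x ∷ peaks (x ∷ y ∷ β)     ≡⟨ cong (λ p → peaks (α ∷ʳ w) ++ x ∷ p) (peaks-∷-desc β y<x) ⟩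
  peaks (α ∷ʳ w) ++ x ∷ peaks (y ∷ β)         ∎
  where open ≡-Reasoning

peaks-hill-insertˡ : ∀ α w v x y β → w < v → v < x → y < x →
  peaks ((α ∷ʳ w) ++ v ∷ x ∷ y ∷ β) ≡ peaks (α ∷ʳ w) ++ x ∷ peaks (y ∷ β)
peaks-hill-insertˡ α w v x y β w<v v<x y<x = begin
  peaks ((α ∷ʳ w) ++ v ∷ x ∷ y ∷ β)           ≡⟨ cong peaks (++-assoc α (w ∷ []) (v ∷ x ∷ y ∷ β)) ⟩
  peaks (α ++ w ∷ v ∷ x ∷ y ∷ β)              ≡⟨ peaks-++-asc α w v (x ∷ y ∷ β) w<v ⟩
  peaks (α ∷ʳ w) ++ peaks (w ∷ v ∷ x ∷ y ∷ β) ≡⟨ cong (peaks (α ∷ʳ w) ++_) (peaks-∷-asc (y ∷ β) v<x) ⟩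
  peaks (α ∷ʳ w) ++ peaks (v ∷ x ∷ y ∷ β)     ≡⟨ cong (peaks (α ∷ʳ w) ++_) (peaks-∷-peak β v<x y<x) ⟩
  peaks (α ∷ʳ w) ++ x ∷ peaks (x ∷ y ∷ β)     ≡⟨ cong (λ p → peaks (α ∷ʳ w) ++ x ∷ p) (peaks-∷-desc β y<x) ⟩
  peaks (α ∷ʳ w) ++ x ∷ peaks (y ∷ β)         ∎
  where open ≡-Reasoning

peaks-hill-insertʳ : ∀ α w x v y β → w < x → v < x → y < v →
  peaks ((α ∷ʳ w) ++ x ∷ v ∷ y ∷ β) ≡ peaks (α ∷ʳ w) ++ x ∷ peaks (y ∷ β)
peaks-hill-insertʳ α w x v y β w<x v<x y<v = begin
  peaks ((α ∷ʳ w) ++ x ∷ v ∷ y ∷ β)           ≡⟨ cong peaks (++-assoc α (w ∷ []) (x ∷ v ∷ y ∷ β)) ⟩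
  peaks (α ++ w ∷ x ∷ v ∷ y ∷ β)              ≡⟨ peaks-++-asc α w x (v ∷ y ∷ β) w<x ⟩
  peaks (α ∷ʳ w) ++ peaks (w ∷ x ∷ v ∷ y ∷ β) ≡⟨ cong (peaks (α ∷ʳ w) ++_) (peaks-∷-peak (y ∷ β) w<x v<x) ⟩
  peaks (α ∷ʳ w) ++ x ∷ peaks (x ∷ v ∷ y ∷ β) ≡⟨ cong (λ p → peaks (α ∷ʳ w) ++ x ∷ p) (peaks-∷-desc (y ∷ β) v<x) ⟩
  peaks (α ∷ʳ w) ++ x ∷ peaks (v ∷ y ∷ β)     ≡⟨ cong (λ p → peaks (α ∷ʳ w) ++ x ∷ p) (peaks-∷-desc β y<v) ⟩
  peaks (α ∷ʳ w) ++ x ∷ peaks (y ∷ β)         ∎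
  where open ≡-Reasoning

peaks-hill-valley-hill : ∀ α w x v t z β → w < x → v < x → v < t → z < t →
  peaks ((α ∷ʳ w) ++ x ∷ v ∷ t ∷ z ∷ β) ≡ peaks (α ∷ʳ w) ++ x ∷ t ∷ peaks (z ∷ β)
peaks-hill-valley-hill α w x v t z β w<x v<x v<t z<t = begin
  peaks ((α ∷ʳ w) ++ x ∷ v ∷ t ∷ z ∷ β)           ≡⟨ cong peaks (++-assoc α (w ∷ []) (x ∷ v ∷ t ∷ z ∷ β)) ⟩
  peaks (α ++ w ∷ x ∷ v ∷ t ∷ z ∷ β)              ≡⟨ peaks-++-asc α w x (v ∷ t ∷ z ∷ β) w<x ⟩
  peaks (α ∷ʳ w) ++ peaks (w ∷ x ∷ v ∷ t ∷ z ∷ β) ≡⟨ cong (peaks (α ∷ʳ w) ++_) (peaks-∷-peak (t ∷ z ∷ β) w<x v<x) ⟩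
  peaks (α ∷ʳ w) ++ x ∷ peaks (x ∷ v ∷ t ∷ z ∷ β) ≡⟨ cong (λ p → peaks (α ∷ʳ w) ++ x ∷ p) (peaks-∷-desc (t ∷ z ∷ β) v<x) ⟩
  peaks (α ∷ʳ w) ++ x ∷ peaks (v ∷ t ∷ z ∷ β)     ≡⟨ cong (λ p → peaks (α ∷ʳ w) ++ x ∷ p) (peaks-∷-peak β v<t z<t) ⟩
  peaks (α ∷ʳ w) ++ x ∷ t ∷ peaks (t ∷ z ∷ β)     ≡⟨ cong (λ p → peaks (α ∷ʳ w) ++ x ∷ t ∷ p) (peaks-∷-desc β z<t) ⟩
  peaks (α ∷ʳ w) ++ x ∷ t ∷ peaks (z ∷ β)         ∎
  where open ≡-Reasoning

PeaksAbove : ℕ → List ℕ → Set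
PeaksAbove v ρ = ∀ x → x ∈ ρ → v < x → x ∈ peaks ρ

PeaksAbove⇒IsolatedAbove : ∀ {v ρ} → Unique ρ → PeaksAbove v ρ → IsolatedAbove v ρ
PeaksAbove⇒IsolatedAbove {v} {ρ} u above α x β refl v<x
  with peak-neighbours ρ x α β u (above x (∈-++⁺ʳ α (here refl)) v<x) refl
... | α′ , w , y , β′ , refl , refl , w<x , y<x = α′ , w , y , β′ , refl , refl , v≮w , v≮y
  where
  v≮w : ¬ v < w
  v≮w v<w with peak-neighbours ρ w α′ (x ∷ y ∷ β′) u (above w (∈-++⁺ˡ (∈-++⁺ʳ α′ (here refl))) v<w)
                 (++-assoc α′ (w ∷ []) (x ∷ y ∷ β′))
  ... | _ , _ , _ , _ , _ , refl , _ , x<w = <-asym w<x x<w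
  v≮y : ¬ v < y
  v≮y v<y with peak-neighbours ρ y ((α′ ∷ʳ w) ∷ʳ x) β′ u (above y (∈-++⁺ʳ (α′ ∷ʳ w) (there (here refl))) v<y)
                 (sym (++-assoc (α′ ∷ʳ w) (x ∷ []) (y ∷ β′)))
  ... | _ , a , _ , _ , eq , _ , a<y , _ with ∷ʳ-injectiveʳ (α′ ∷ʳ w) _ eq
  ... | refl = <-asym y<x a<y

below : ∀ {v w} ρ → v ∉ ρ → w ∈ ρ → ¬ v < w → w < v
below ρ v∉ w∈ v≮w = ≤∧≢⇒< (≮⇒≥ v≮w) (λ { refl → v∉ w∈ })

neighbours-below : ∀ {v ρ} → v ∉ ρ → IsolatedAbove v ρ → ∀ α x β → ρ ≡ α ++ x ∷ β → v < x →
  ∃ λ α′ → ∃ λ w → ∃ λ y → ∃ λ β′ → α ≡ α′ ∷ʳ w × β ≡ y ∷ β′ × w < v × y < v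
neighbours-below {ρ = ρ} v∉ isolated α x β refl v<x with isolated α x β refl v<x
... | α′ , w , y , β′ , refl , refl , v≮w , v≮y = α′ , w , y , β′ , refl , refl ,
  below ρ v∉ (∈-++⁺ˡ (∈-++⁺ʳ α′ (here refl))) v≮w , below ρ v∉ (∈-++⁺ʳ (α′ ∷ʳ w) (there (here refl))) v≮y

peaks-insertions₁ : ∀ {v ρ σ} → v ∉ ρ → IsolatedAbove v ρ → σ ∈ insertions₁ v ρ → peaks σ ≡ peaks ρ
peaks-insertions₁ {ρ = []}    _  _        (here refl) = refl
peaks-insertions₁ {ρ = y ∷ β} v∉ isolated (here refl) =
  peaks-∷-desc β (below (y ∷ β) v∉ (here refl) (IsolatedAbove-head isolated refl))
peaks-insertions₁ {v} {ρ} v∉ isolated (there (here refl)) with initLast ρ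
... | []      = refl
... | α ∷ʳ′ w = trans (cong peaks (++-assoc α (w ∷ []) (v ∷ [])))
  (peaks-∷ʳ-asc α (below (α ∷ʳ w) v∉ (∈-++⁺ʳ α (here refl)) (IsolatedAbove-last isolated refl)))
peaks-insertions₁ {v} {ρ} v∉ isolated (there (there p)) with ∈-insertNextToLarger⁻ v ρ p
... | α , x , β , refl , v<x , form with neighbours-below v∉ isolated α x β refl v<x
...   | α′ , w , y , β′ , refl , refl , w<v , y<v with form
...     | inj₁ refl = trans (peaks-hill-insertˡ α′ w v x y β′ w<v v<x (<-trans y<v v<x))
                            (sym (peaks-hill α′ w x y β′ (<-trans w<v v<x) (<-trans y<v v<x)))
...     | inj₂ refl = trans (peaks-hill-insertʳ α′ w x v y β′ (<-trans w<v v<x) v<x y<v)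
                            (sym (peaks-hill α′ w x y β′ (<-trans w<v v<x) (<-trans y<v v<x)))

AddsPeak : ℕ → List ℕ → List ℕ → Set
AddsPeak t ρ σ = ∃ λ P → ∃ λ Q → peaks ρ ≡ P ++ Q × peaks σ ≡ P ++ t ∷ Q

peaks-insertions₂ : ∀ {v t ρ σ} → v ∉ ρ → IsolatedAbove v ρ → v < t → ρ ≢ [] → σ ∈ insertions₂ v t ρ →
  AddsPeak t ρ σ
peaks-insertions₂ {ρ = []}    _  _        _   ρ≢[] (here refl) = ⊥-elim (ρ≢[] refl)
peaks-insertions₂ {t = t} {ρ = z ∷ β} v∉ isolated v<t _    (here refl) =
  [] , peaks (z ∷ β) , refl ,
  trans (peaks-∷-peak β v<t z<t) (cong (_ ∷_) (peaks-∷-desc β z<t))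
  where
  z<t : z < t
  z<t = <-trans (below (z ∷ β) v∉ (here refl) (IsolatedAbove-head isolated refl)) v<t
peaks-insertions₂ {v} {t} {ρ} v∉ isolated v<t ρ≢[] (there (here refl)) with initLast ρ
... | []      = ⊥-elim (ρ≢[] refl)
... | α ∷ʳ′ w = peaks (α ∷ʳ w) , [] , sym (++-identityʳ _) ,
  trans (cong peaks (++-assoc α (w ∷ []) (t ∷ v ∷ [])))
    (trans (peaks-++-asc α w t (v ∷ []) w<t) (cong (peaks (α ∷ʳ w) ++_) (peaks-∷-peak [] w<t v<t)))
  where
  w<t : w < t
  w<t = <-trans (below (α ∷ʳ w) v∉ (∈-++⁺ʳ α (here refl)) (IsolatedAbove-last isolated refl)) v<t
peaks-insertions₂ {v} {t} {ρ} v∉ isolated v<t _ (there (there p)) with ∈-insertAfterLarger⁻ v t ρ p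
... | α , x , β , refl , v<x , refl with neighbours-below v∉ isolated α x β refl v<x
...   | α′ , w , z , β′ , refl , refl , w<v , z<v =
  peaks (α′ ∷ʳ w) ∷ʳ x , peaks (z ∷ β′) ,
  trans (peaks-hill α′ w x z β′ (<-trans w<v v<x) (<-trans z<v v<x)) (sym (++-assoc (peaks (α′ ∷ʳ w)) (x ∷ []) _)) ,
  trans (peaks-hill-valley-hill α′ w x v t z β′ (<-trans w<v v<x) v<x v<t (<-trans z<v v<t))
        (sym (++-assoc (peaks (α′ ∷ʳ w)) (x ∷ []) _))

FromInsertions₁ : ℕ → List ℕ → Set
FromInsertions₁ v σ = ∃ λ ρ → σ ∈ insertions₁ v ρ × peaks σ ≡ peaks ρ

FromInsertions₂ : ℕ → List ℕ → Set
FromInsertions₂ v σ = ∃ λ t → ∃ λ ρ → v < t × σ ∈ insertions₂ v t ρ × AddsPeak t ρ σ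

decompose-front : ∀ {v} β → v ∉ β → Unique (v ∷ β) → PeaksAbove v (v ∷ β) →
  FromInsertions₁ v (v ∷ β) ⊎ FromInsertions₂ v (v ∷ β)
decompose-front         []      _  _ _     = inj₁ ([] , here refl , refl)
decompose-front {v} (y ∷ β) v∉ u above with v <? y
... | no  v≮y = inj₁ (y ∷ β , here refl , peaks-∷-desc β (below (y ∷ β) v∉ (here refl) v≮y))
... | yes v<y with peak-neighbours (v ∷ y ∷ β) y (v ∷ []) β u (above y (there (here refl)) v<y) refl
...   | _ , _ , z , β′ , _ , refl , _ , z<y =
  inj₂ (y , z ∷ β′ , v<y , here refl , [] , peaks (z ∷ β′) , refl ,
        trans (peaks-∷-peak β′ v<y z<y) (cong (y ∷_) (peaks-∷-desc β′ z<y)))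

decompose-back : ∀ {v} α x → v ∉ α ∷ʳ x → Unique ((α ∷ʳ x) ++ v ∷ []) → PeaksAbove v ((α ∷ʳ x) ++ v ∷ []) →
  FromInsertions₁ v ((α ∷ʳ x) ++ v ∷ []) ⊎ FromInsertions₂ v ((α ∷ʳ x) ++ v ∷ [])
decompose-back {v} α x v∉ u above with v <? x
... | no v≮x = inj₁ (α ∷ʳ x , there (here refl) ,
  trans (cong peaks (++-assoc α (x ∷ []) (v ∷ []))) (peaks-∷ʳ-asc α (below (α ∷ʳ x) v∉ (∈-++⁺ʳ α (here refl)) v≮x)))
... | yes v<x
  with peak-neighbours _ x α (v ∷ []) u (above x (∈-++⁺ˡ (∈-++⁺ʳ α (here refl))) v<x) (++-assoc α (x ∷ []) (v ∷ []))
...   | α′ , w , _ , _ , refl , refl , w<x , _ =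
  inj₂ (x , α′ ∷ʳ w , v<x , subst (_∈ insertions₂ v x (α′ ∷ʳ w)) (sym (++-assoc (α′ ∷ʳ w) (x ∷ []) (v ∷ []))) (there (here refl)) ,
        peaks (α′ ∷ʳ w) , [] , sym (++-identityʳ _) ,
        trans (cong peaks (trans (++-assoc (α′ ∷ʳ w) (x ∷ []) (v ∷ [])) (++-assoc α′ (w ∷ []) (x ∷ v ∷ []))))
          (trans (peaks-++-asc α′ w x (v ∷ []) w<x) (cong (peaks (α′ ∷ʳ w) ++_) (peaks-∷-peak [] w<x v<x))))

decompose-valley : ∀ {v} α x y β → v ∉ y ∷ β → let σ = (α ∷ʳ x) ++ v ∷ y ∷ β in
  Unique σ → PeaksAbove v σ → v < x → v < y → FromInsertions₂ v σ
decompose-valley {v} α x y β v∉β u above v<x v<y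
  with peak-neighbours _ x α (v ∷ y ∷ β) u (above x (∈-++⁺ˡ (∈-++⁺ʳ α (here refl))) v<x) (++-assoc α (x ∷ []) _)
... | α′ , w , _ , _ , refl , refl , w<x , _
  with PeaksAbove⇒IsolatedAbove u above (((α′ ∷ʳ w) ∷ʳ x) ∷ʳ v) y β (sym (++-assoc ((α′ ∷ʳ w) ∷ʳ x) (v ∷ []) (y ∷ β))) v<y
... | _ , _ , z , β′ , _ , refl , _ , v≮z = y , (α′ ∷ʳ w) ++ x ∷ z ∷ β′ , v<y ,
  subst (_∈ insertions₂ v y ((α′ ∷ʳ w) ++ x ∷ z ∷ β′)) (sym (++-assoc (α′ ∷ʳ w) (x ∷ []) (v ∷ y ∷ z ∷ β′)))
    (there (there (∈-insertAfterLarger⁺ v y (α′ ∷ʳ w) (z ∷ β′) v<x))) ,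
  peaks (α′ ∷ʳ w) ∷ʳ x , peaks (z ∷ β′) ,
  trans (peaks-hill α′ w x z β′ w<x (<-trans z<v v<x)) (sym (++-assoc (peaks (α′ ∷ʳ w)) (x ∷ []) _)) ,
  trans (cong peaks (++-assoc (α′ ∷ʳ w) (x ∷ []) (v ∷ y ∷ z ∷ β′)))
    (trans (peaks-hill-valley-hill α′ w x v y z β′ w<x v<x v<y (<-trans z<v v<y))
           (sym (++-assoc (peaks (α′ ∷ʳ w)) (x ∷ []) _)))
  where
  z<v : z < v
  z<v = below (y ∷ z ∷ β′) v∉β (there (here refl)) v≮z

decompose-middle : ∀ {v} α x y β → v ∉ α ∷ʳ x → v ∉ y ∷ β →
  let σ = (α ∷ʳ x) ++ v ∷ y ∷ β in
  Unique σ → PeaksAbove v σ → v ∉ peaks σ → FromInsertions₁ v σ ⊎ FromInsertions₂ v σ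
decompose-middle {v} α x y β v∉α v∉β u above v∉peaks with v <? x | v <? y
... | no v≮x | no v≮y = ⊥-elim (v∉peaks (subst (λ s → v ∈ peaks s) (sym (++-assoc α (x ∷ []) _))
        (∈-peaks⁺ α β (below (α ∷ʳ x) v∉α (∈-++⁺ʳ α (here refl)) v≮x) (below (y ∷ β) v∉β (here refl) v≮y))))
... | yes v<x | no v≮y
  with peak-neighbours _ x α (v ∷ y ∷ β) u (above x (∈-++⁺ˡ (∈-++⁺ʳ α (here refl))) v<x) (++-assoc α (x ∷ []) _)
...   | α′ , w , _ , _ , refl , refl , w<x , _ = inj₁ ((α′ ∷ʳ w) ++ x ∷ y ∷ β ,
  subst (_∈ insertions₁ v ((α′ ∷ʳ w) ++ x ∷ y ∷ β)) (sym (++-assoc (α′ ∷ʳ w) (x ∷ []) (v ∷ y ∷ β)))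
    (there (there (proj₂ (∈-insertNextToLarger⁺ v (α′ ∷ʳ w) (y ∷ β) v<x)))) ,
  trans (cong peaks (++-assoc (α′ ∷ʳ w) (x ∷ []) (v ∷ y ∷ β)))
    (trans (peaks-hill-insertʳ α′ w x v y β w<x v<x y<v) (sym (peaks-hill α′ w x y β w<x (<-trans y<v v<x)))))
  where
  y<v : y < v
  y<v = below (y ∷ β) v∉β (here refl) v≮y
decompose-middle {v} α x y β v∉α v∉β u above v∉peaks | no v≮x | yes v<y
  with peak-neighbours _ y ((α ∷ʳ x) ∷ʳ v) β u (above y (∈-++⁺ʳ (α ∷ʳ x) (there (here refl))) v<y)
         (sym (++-assoc (α ∷ʳ x) (v ∷ []) (y ∷ β)))
... | _ , _ , z , β′ , _ , refl , _ , z<y = inj₁ ((α ∷ʳ x) ++ y ∷ z ∷ β′ ,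
  there (there (proj₁ (∈-insertNextToLarger⁺ v (α ∷ʳ x) (z ∷ β′) v<y))) ,
  trans (peaks-hill-insertˡ α x v y z β′ x<v v<y z<y) (sym (peaks-hill α x y z β′ (<-trans x<v v<y) z<y)))
  where
  x<v : x < v
  x<v = below (α ∷ʳ x) v∉α (∈-++⁺ʳ α (here refl)) v≮x
decompose-middle α x y β v∉α v∉β u above v∉peaks | yes v<x | yes v<y =
  inj₂ (decompose-valley α x y β v∉β u above v<x v<y)

decompose : ∀ {v σ} → Unique σ → PeaksAbove v σ → v ∉ peaks σ → v ∈ σ → FromInsertions₁ v σ ⊎ FromInsertions₂ v σ
decompose {v} u above v∉peaks v∈ with ∈-∃++ v∈
... | α , β , refl with Unique-∉-split α u
... | v∉ with initLast α | β
...   | []      | β        = decompose-front β v∉ u above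
...   | α′ ∷ʳ′ x | []       = decompose-back α′ x (v∉ ∘ ∈-++⁺ˡ) u above
...   | α′ ∷ʳ′ x | y ∷ β′   = decompose-middle α′ x y β′ (v∉ ∘ ∈-++⁺ˡ) (v∉ ∘ ∈-++⁺ʳ (α′ ∷ʳ x)) u above v∉peaks

module _ (w : ℕ) (τ : List ℕ) {P Q : ℕ → Set} (P⇔Q : ∀ y → P y ⇔ Q (punchIn w y)) where

  HasPeakSet-punchIn⁺ : (∀ x → Q x → x ≢ w) → HasPeakSet τ P → HasPeakSet (map (punchIn w) τ) Q
  HasPeakSet-punchIn⁺ Q⇒≢w (sound , complete) = sound′ , complete′
    where
    sound′ : ∀ x → x ∈ peaks (map (punchIn w) τ) → Q x
    sound′ x p with ∈-map⁻ (punchIn w) (subst (x ∈_) (peaks-punchIn w τ) p)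
    ... | y , y∈ , refl = Equivalence.to (P⇔Q y) (sound y y∈)
    complete′ : ∀ x → Q x → x ∈ peaks (map (punchIn w) τ)
    complete′ x q = subst (_∈ _) (punchIn-punchOut w (Q⇒≢w x q))
      (subst (_ ∈_) (sym (peaks-punchIn w τ))
        (∈-map⁺ (punchIn w) (complete _ (Equivalence.from (P⇔Q _) (subst Q (sym (punchIn-punchOut w (Q⇒≢w x q))) q)))))

  HasPeakSet-punchIn⁻ : HasPeakSet (map (punchIn w) τ) Q → HasPeakSet τ P
  HasPeakSet-punchIn⁻ (sound , complete) = sound′ , complete′
    where
    sound′ : ∀ y → y ∈ peaks τ → P y
    sound′ y p = Equivalence.from (P⇔Q y)
      (sound _ (subst (_ ∈_) (sym (peaks-punchIn w τ)) (∈-map⁺ (punchIn w) p)))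
    complete′ : ∀ y → P y → y ∈ peaks τ
    complete′ y py with ∈-map⁻ (punchIn w) (subst (_ ∈_) (peaks-punchIn w τ) (complete _ (Equivalence.to (P⇔Q y) py)))
    ... | z , z∈ , e rewrite punchIn-injective w e = z∈

module _ {S : List ℕ} where

  ∪-punchIn-shift : ∀ {v m} → All (_< v) S → ∀ y → (S ∪[ v , m ]) y ⇔ (S ∪[ suc v , suc m ]) (punchIn v y)
  ∪-punchIn-shift {v} {m} S<v y = mk⇔ to from
    where
    to : (S ∪[ v , m ]) y → (S ∪[ suc v , suc m ]) (punchIn v y)
    to (inj₁ y∈S)        rewrite punchIn-< (All.lookup S<v y∈S) = inj₁ y∈S
    to (inj₂ (v≤y , y≤m)) rewrite punchIn-≥ v≤y = inj₂ (s≤s v≤y , s≤s y≤m)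
    from : (S ∪[ suc v , suc m ]) (punchIn v y) → (S ∪[ v , m ]) y
    from q with y <? v
    from q | yes y<v rewrite punchIn-< y<v with q
    ... | inj₁ y∈S      = inj₁ y∈S
    ... | inj₂ (v<y , _) = ⊥-elim (<-asym y<v v<y)
    from q | no  y≮v rewrite punchIn-≥ (≮⇒≥ y≮v) with q
    ... | inj₁ sy∈S         = ⊥-elim (<-asym (All.lookup S<v sy∈S) (s≤s (≮⇒≥ y≮v)))
    ... | inj₂ (_ , s≤s y≤m) = inj₂ (≮⇒≥ y≮v , y≤m)

  ∪-punchIn-widen : ∀ {w a b} → All (_< w) S → a ≤ w → w ≤ suc b →
    ∀ z → (S ∪[ a , b ]) z ⇔ ((S ∪[ a , suc b ]) (punchIn w z) × punchIn w z ≢ w)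
  ∪-punchIn-widen {w} {a} {b} S<w a≤w w≤sb z = mk⇔ to from
    where
    to : (S ∪[ a , b ]) z → (S ∪[ a , suc b ]) (punchIn w z) × punchIn w z ≢ w
    to (inj₁ z∈S)         rewrite punchIn-< (All.lookup S<w z∈S) = inj₁ z∈S , λ { refl → <-irrefl refl (All.lookup S<w z∈S) }
    to (inj₂ (a≤z , z≤b)) =
      inj₂ (≤-trans a≤z (n≤punchIn w z) , ≤-trans (punchIn≤suc w z) (s≤s z≤b)) , punchIn≢ w z
    from : (S ∪[ a , suc b ]) (punchIn w z) × punchIn w z ≢ w → (S ∪[ a , b ]) z
    from (q , _) with z <? w
    from (q , _) | yes z<w rewrite punchIn-< z<w with q
    ... | inj₁ z∈S        = inj₁ z∈S
    ... | inj₂ (a≤z , _)  = inj₂ (a≤z , ≤-pred (<-≤-trans z<w w≤sb))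
    from (q , _) | no  z≮w rewrite punchIn-≥ (≮⇒≥ z≮w) with q
    ... | inj₁ sz∈S          = ⊥-elim (<-asym (All.lookup S<w sz∈S) (s≤s (≮⇒≥ z≮w)))
    ... | inj₂ (_ , s≤s z≤b) = inj₂ (≤-trans a≤w (≮⇒≥ z≮w) , z≤b)

countAbove-map : ∀ {u v} (f : ℕ → ℕ) xs → (∀ x → u < x ⇔ v < f x) → countAbove v (map f xs) ≡ countAbove u xs
countAbove-map f [] _ = refl
countAbove-map {u} {v} f (x ∷ xs) above⇔ with u <? x
... | yes u<x = begin
  length (filter (v <?_) (f x ∷ map f xs))  ≡⟨ cong length (filter-accept (v <?_) {xs = map f xs} (Equivalence.to (above⇔ x) u<x)) ⟩
  suc (countAbove v (map f xs))             ≡⟨ cong suc (countAbove-map f xs above⇔) ⟩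
  suc (countAbove u xs)                     ≡⟨ cong length (filter-accept (u <?_) {xs = xs} u<x) ⟨
  countAbove u (x ∷ xs)                     ∎
  where open ≡-Reasoning
... | no  u≮x = begin
  length (filter (v <?_) (f x ∷ map f xs))  ≡⟨ cong length (filter-reject (v <?_) {xs = map f xs} (u≮x ∘ Equivalence.from (above⇔ x))) ⟩
  countAbove v (map f xs)                   ≡⟨ countAbove-map f xs above⇔ ⟩
  countAbove u xs                           ≡⟨ cong length (filter-reject (u <?_) {xs = xs} u≮x) ⟨
  countAbove u (x ∷ xs)                     ∎
  where open ≡-Reasoning

countAbove-perm : ∀ {m τ} u → IsPerm m τ → countAbove u τ ≡ m ∸ u
countAbove-perm {m} {τ} u perm@(_ , u-τ , bounds) = begin
  countAbove u τ             ≡⟨ unique∧sameElems⇒length≡ (filter⁺ (u <?_) u-τ) (Unique-range (suc u) m) to from ⟩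
  length (range (suc u) m)   ≡⟨ length-range (suc u) m ⟩
  suc m ∸ suc u              ∎
  where
  open ≡-Reasoning
  to : ∀ {z} → z ∈ filter (u <?_) τ → z ∈ range (suc u) m
  to p with ∈-filter⁻ (u <?_) p
  ... | z∈ , u<z = ∈-range⁺ u<z (proj₂ (All.lookup bounds z∈))
  from : ∀ {z} → z ∈ range (suc u) m → z ∈ filter (u <?_) τ
  from p with ∈-range⁻ p
  ... | u<z , z≤m = ∈-filter⁺ (u <?_) (IsPerm-∈ perm (≤-trans (s≤s z≤n) u<z , z≤m)) u<z

IsArrangement-insert : ∀ {m l} α {x β} → IsArrangement m l (α ++ β) → x ∉ α ++ β → x ∈[1, m ] →
  IsArrangement m (suc l) (α ++ x ∷ β)
IsArrangement-insert α {x} {β} (len , u , bounds) x∉ x∈ =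
  trans (length-++-∷ α x β) (cong suc len) , Unique-insert α u x∉ , All.tabulate bounded
  where
  bounded : ∀ {y} → y ∈ α ++ x ∷ β → y ∈[1, _ ]
  bounded p with ∈-++-∷⁻ α β p
  ... | inj₁ refl = x∈
  ... | inj₂ q    = All.lookup bounds q

IsArrangement-remove : ∀ {m l} α {x β} → IsArrangement m (suc l) (α ++ x ∷ β) →
  IsArrangement m l (α ++ β) × x ∉ α ++ β × x ∈[1, m ]
IsArrangement-remove α {x} {β} (len , u , bounds) =
  (suc-injective (trans (sym (length-++-∷ α x β)) len) , Unique-remove α u ,
   All.tabulate (All.lookup bounds ∘ ∈-++-∷⁺ α β)) ,
  Unique-∉-split α u , All.lookup bounds (∈-++⁺ʳ α (here refl))

IsArrangement-punchIn : ∀ {m l τ} w → IsArrangement m l τ → IsArrangement (suc m) l (map (punchIn w) τ)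
IsArrangement-punchIn {τ = τ} w (len , u , bounds) =
  trans (length-map (punchIn w) τ) len , map⁺ (punchIn-injective w) u , All-map⁺ (All.map (punchIn-∈[1,] w) bounds)

IsArrangement-punchOut : ∀ {m l ρ w} → 1 ≤ w → w ≤ suc m → w ∉ ρ → IsArrangement (suc m) l ρ →
  IsArrangement m l (map (punchOut w) ρ)
IsArrangement-punchOut {m} {l} {ρ} {w} 1≤w w≤sm w∉ (len , u , bounds) =
  trans (length-map (punchOut w) ρ) len ,
  map⁻ (subst Unique (sym (map-punchIn-punchOut w ρ w∉)) u) ,
  All.tabulate bounded
  where
  bounded : ∀ {y} → y ∈ map (punchOut w) ρ → y ∈[1, m ]
  bounded p with ∈-map⁻ (punchOut w) p
  ... | x , x∈ , refl = punchIn-∈[1,]⁻ 1≤w w≤sm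
    (subst (_∈[1, suc m ]) (sym (punchIn-punchOut w (λ { refl → w∉ x∈ }))) (All.lookup bounds x∈))

HasPeakSet-peaks≡ : ∀ σ ρ {P} → peaks σ ≡ peaks ρ → HasPeakSet ρ P → HasPeakSet σ P
HasPeakSet-peaks≡ σ ρ eq (sound , complete) =
  (λ x p → sound x (subst (x ∈_) eq p)) , (λ x q → subst (x ∈_) (sym eq) (complete x q))

HasPeakSet-AddsPeak⁺ : ∀ {t} ρ σ {P : ℕ → Set} → AddsPeak t ρ σ → P t →
  HasPeakSet ρ (λ x → P x × x ≢ t) → HasPeakSet σ P
HasPeakSet-AddsPeak⁺ {t} ρ σ {P} (Pk , Qk , eqρ , eqσ) Pt (sound , complete) = sound′ , complete′
  where
  sound′ : ∀ x → x ∈ peaks σ → P x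
  sound′ x p with ∈-++-∷⁻ Pk Qk (subst (x ∈_) eqσ p)
  ... | inj₁ refl = Pt
  ... | inj₂ q    = proj₁ (sound x (subst (x ∈_) (sym eqρ) q))
  complete′ : ∀ x → P x → x ∈ peaks σ
  complete′ x Px with x ≟ t
  ... | yes refl = subst (x ∈_) (sym eqσ) (∈-++⁺ʳ Pk (here refl))
  ... | no  x≢t  = subst (x ∈_) (sym eqσ) (∈-++-∷⁺ Pk Qk (subst (x ∈_) eqρ (complete x (Px , x≢t))))

HasPeakSet-AddsPeak⁻ : ∀ {t} ρ σ {P : ℕ → Set} → t ∉ ρ → AddsPeak t ρ σ →
  HasPeakSet σ P → HasPeakSet ρ (λ x → P x × x ≢ t)
HasPeakSet-AddsPeak⁻ {t} ρ σ {P} t∉ (Pk , Qk , eqρ , eqσ) (sound , complete) = sound′ , complete′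
  where
  sound′ : ∀ x → x ∈ peaks ρ → P x × x ≢ t
  sound′ x p = sound x (subst (x ∈_) (sym eqσ) (∈-++-∷⁺ Pk Qk (subst (x ∈_) eqρ p))) ,
               λ { refl → t∉ (peaks⊆ ρ p) }
  complete′ : ∀ x → P x × x ≢ t → x ∈ peaks ρ
  complete′ x (Px , x≢t) with ∈-++-∷⁻ Pk Qk (subst (x ∈_) eqσ (complete x Px))
  ... | inj₁ x≡t = ⊥-elim (x≢t x≡t)
  ... | inj₂ q   = subst (x ∈_) (sym eqρ) q

IsArrangement-insert₂ : ∀ {m l} α β {x y σ} → PairInsertion α β x y σ → IsArrangement m l (α ++ β) →
  x ∉ α ++ β → y ∉ α ++ β → x ≢ y → x ∈[1, m ] → y ∈[1, m ] → IsArrangement m (suc (suc l)) σ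
IsArrangement-insert₂ α β (inj₁ refl) arr x∉ y∉ x≢y x∈ y∈ =
  IsArrangement-insert α (IsArrangement-insert α arr y∉ y∈) (∉-++-∷ α β x≢y x∉) x∈
IsArrangement-insert₂ {m} {l} α β {x} {y} (inj₂ (refl , refl)) arr x∉ y∉ x≢y x∈ y∈ =
  subst (IsArrangement m _) (++-assoc α (y ∷ []) (x ∷ []))
    (IsArrangement-insert (α ∷ʳ y) (subst (IsArrangement m _) (sym (++-identityʳ (α ∷ʳ y))) with-y)
      (subst (x ∉_) (sym (++-identityʳ (α ∷ʳ y))) (∉-++-∷ α [] x≢y x∉)) x∈)
  where
  with-y : IsArrangement m (suc l) (α ++ y ∷ [])
  with-y = IsArrangement-insert α arr y∉ y∈

IsArrangement-remove₂ : ∀ {m l} α β {x y σ} → PairInsertion α β x y σ → IsArrangement m (suc (suc l)) σ →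
  IsArrangement m l (α ++ β) × x ∉ α ++ β × y ∉ α ++ β × y ∈[1, m ]
IsArrangement-remove₂ α β (inj₁ refl) arr with IsArrangement-remove α arr
... | with-y , x∉ , _ with IsArrangement-remove α with-y
... | arr′ , y∉ , y∈ = arr′ , x∉ ∘ ∈-++-∷⁺ α β , y∉ , y∈
IsArrangement-remove₂ {m} α β {x} {y} (inj₂ (refl , refl)) arr
  with IsArrangement-remove (α ∷ʳ y) (subst (IsArrangement m _) (sym (++-assoc α (y ∷ []) (x ∷ []))) arr)
... | with-y , x∉ , _ with IsArrangement-remove α (subst (IsArrangement m _) (++-identityʳ (α ∷ʳ y)) with-y)
... | arr′ , y∉ , y∈ = arr′ , x∉ ∘ ∈-++⁺ˡ ∘ ∈-++⁺ˡ ∘ subst (x ∈_) (++-identityʳ α) , y∉ , y∈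

∉-map-punchIn-below : ∀ {v t ρ} → v < t → v ∉ ρ → v ∉ map (punchIn t) ρ
∉-map-punchIn-below {v} {t} v<t v∉ p with ∈-map⁻ (punchIn t) p
... | x , x∈ , eq with x <? t
...   | yes x<t = v∉ (subst (_∈ _) (trans (sym (punchIn-< x<t)) (sym eq)) x∈)
...   | no  x≮t = <-asym v<t (subst (t <_) (sym eq) (punchIn-above t (≮⇒≥ x≮t)))

∉-map-punchOut-below : ∀ {v t ρ} → v < t → v ∉ ρ → t ∉ ρ → v ∉ map (punchOut t) ρ
∉-map-punchOut-below {v} {t} v<t v∉ t∉ p with ∈-map⁻ (punchOut t) p
... | x , x∈ , eq with x <? t
...   | yes x<t = v∉ (subst (_∈ _) (trans (sym (punchOut-< x<t)) (sym eq)) x∈)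
...   | no  x≮t = <-irrefl refl (<-≤-trans v<t (subst (t ≤_) (sym (trans eq (punchOut-≥ (≮⇒≥ x≮t)))) (<⇒≤pred t<x)))
  where
  t<x : t < x
  t<x = ≤∧≢⇒< (≮⇒≥ x≮t) λ { refl → t∉ x∈ }

above-punchIn-self : ∀ u x → u < x ⇔ suc u < punchIn (suc u) x
above-punchIn-self u x = mk⇔ to from
  where
  to : u < x → suc u < punchIn (suc u) x
  to u<x = punchIn-above (suc u) u<x
  from : suc u < punchIn (suc u) x → u < x
  from p with x <? suc u
  ... | yes x<v rewrite punchIn-< x<v = ⊥-elim (<-asym p x<v)
  ... | no  x≮v = ≮⇒≥ x≮v

above-punchIn-higher : ∀ {v t} → v < t → ∀ x → v < x ⇔ v < punchIn t x
above-punchIn-higher {v} {t} v<t x = mk⇔ to from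
  where
  to : v < x → v < punchIn t x
  to v<x = <-≤-trans v<x (n≤punchIn t x)
  from : v < punchIn t x → v < x
  from p with x <? t
  ... | yes x<t rewrite punchIn-< x<t = p
  ... | no  x≮t = <-≤-trans v<t (≮⇒≥ x≮t)

-- v = u + 1 and n = n₂ + 2, so that n − 1, n − 2 and v − 1 need no truncated subtraction.
module Counting (u n₂ : ℕ) (S : List ℕ) (1≤u : 1 ≤ u) (u≤n₁ : u ≤ suc n₂) (S<v : All (_< suc u) S) where

  v n₁ n : ℕ
  v  = suc u
  n₁ = suc n₂
  n  = suc n₁

  Target : ℕ → Set
  Target = S ∪[ suc v , n ]

  L A B : List (List ℕ)
  L = cpList n  (S ++ range (suc v) n)
  A = cpList n₁ (S ++ range v n₁)
  B = cpList n₂ (S ++ range v n₂)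

  tops : List ℕ
  tops = range (suc v) n

  lift₁ : List ℕ → List ℕ
  lift₁ τ = map (punchIn v) τ

  lift₂ : ℕ → List ℕ → List ℕ
  lift₂ t τ = map (punchIn t) (lift₁ τ)

  family₂ : List ℕ → List (List ℕ)
  family₂ τ = concatMap (λ t → insertions₂ v t (lift₂ t τ)) tops

  M₁ M₂ : List (List ℕ)
  M₁ = concatMap (insertions₁ v ∘ lift₁) A
  M₂ = concatMap family₂ B

  v∈[1,n] : v ∈[1, n ]
  v∈[1,n] = s≤s z≤n , s≤s u≤n₁

  above-v⇒≢v : ∀ {b x} → (S ∪[ suc v , b ]) x → x ≢ v
  above-v⇒≢v (inj₁ x∈S)       refl = <-irrefl refl (All.lookup S<v x∈S)
  above-v⇒≢v (inj₂ (v<x , _)) refl = <-irrefl refl v<x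

  record Reduced₁ (ρ : List ℕ) : Set where
    field
      arrangement : IsArrangement n n₁ ρ
      v∉          : v ∉ ρ
      peakSet     : HasPeakSet ρ Target

    isolated : IsolatedAbove v ρ
    isolated = PeaksAbove⇒IsolatedAbove (proj₁ (proj₂ arrangement))
      λ x x∈ v<x → proj₂ peakSet x (inj₂ (v<x , proj₂ (All.lookup (proj₂ (proj₂ arrangement)) x∈)))

    nonempty : ρ ≢ []
    nonempty refl with () ← proj₁ arrangement

  record Reduced₂ (t : ℕ) (ρ : List ℕ) : Set where
    field
      v<t         : v < t
      t≤n         : t ≤ n
      arrangement : IsArrangement n n₂ ρ
      v∉          : v ∉ ρ
      t∉          : t ∉ ρ
      peakSet     : HasPeakSet ρ (λ x → Target x × x ≢ t)

    isolated : IsolatedAbove v ρ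
    isolated = PeaksAbove⇒IsolatedAbove (proj₁ (proj₂ arrangement))
      λ x x∈ v<x → proj₂ peakSet x (inj₂ (v<x , proj₂ (All.lookup (proj₂ (proj₂ arrangement)) x∈)) ,
                                   λ { refl → t∉ x∈ })

    nonempty : ρ ≢ []
    nonempty refl with refl ← proj₁ arrangement = <-irrefl refl (<-≤-trans (s≤s (s≤s 1≤u)) (≤-trans v<t t≤n))

  shift-v : ∀ {m} y → (S ∪[ v , m ]) y ⇔ (S ∪[ suc v , suc m ]) (punchIn v y)
  shift-v = ∪-punchIn-shift S<v

  widen-t : ∀ {t} → v < t → t ≤ n → ∀ z → (S ∪[ suc v , n₁ ]) z ⇔ (Target (punchIn t z) × punchIn t z ≢ t)
  widen-t v<t t≤n = ∪-punchIn-widen (All.map (λ x<v → <-trans x<v v<t) S<v) v<t t≤n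

  lift₁-reduced : ∀ {τ} → τ ∈ A → Reduced₁ (lift₁ τ)
  lift₁-reduced {τ} τ∈ with ∈-cpList⁻ τ∈
  ... | perm , peaksτ = record
    { arrangement = IsArrangement-punchIn v perm
    ; v∉          = ∉-map-punchIn v τ
    ; peakSet     = HasPeakSet-punchIn⁺ v τ shift-v (λ _ → above-v⇒≢v) peaksτ
    }

  lower₁ : ∀ {ρ} → Reduced₁ ρ → map (punchOut v) ρ ∈ A × lift₁ (map (punchOut v) ρ) ≡ ρ
  lower₁ {ρ} red = ∈-cpList⁺ perm peaksτ , lifted
    where
    open Reduced₁ red
    τ : List ℕ
    τ = map (punchOut v) ρ
    lifted : lift₁ τ ≡ ρ
    lifted = map-punchIn-punchOut v ρ v∉
    perm : IsPerm n₁ τ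
    perm = IsArrangement-punchOut (s≤s z≤n) (s≤s u≤n₁) v∉ arrangement
    peaksτ : HasPeakSet τ (S ∪[ v , n₁ ])
    peaksτ = HasPeakSet-punchIn⁻ v τ shift-v (subst (λ r → HasPeakSet r Target) (sym lifted) peakSet)

  lift₂-reduced : ∀ {τ t} → τ ∈ B → t ∈ tops → Reduced₂ t (lift₂ t τ)
  lift₂-reduced {τ} {t} τ∈ t∈ with ∈-cpList⁻ τ∈ | ∈-range⁻ t∈
  ... | perm , peaksτ | v<t , t≤n = record
    { v<t         = v<t
    ; t≤n         = t≤n
    ; arrangement = IsArrangement-punchIn t (IsArrangement-punchIn v perm)
    ; v∉          = ∉-map-punchIn-below v<t (∉-map-punchIn v τ)
    ; t∉          = ∉-map-punchIn t (lift₁ τ)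
    ; peakSet     = HasPeakSet-punchIn⁺ t (lift₁ τ) (widen-t v<t t≤n) (λ _ → proj₂)
                      (HasPeakSet-punchIn⁺ v τ shift-v (λ _ → above-v⇒≢v) peaksτ)
    }

  lower₂ : ∀ {t ρ} → Reduced₂ t ρ →
    map (punchOut v) (map (punchOut t) ρ) ∈ B × lift₂ t (map (punchOut v) (map (punchOut t) ρ)) ≡ ρ
  lower₂ {t} {ρ} red = ∈-cpList⁺ perm peaksτ , lifted
    where
    open Reduced₂ red
    ρ′ τ : List ℕ
    ρ′ = map (punchOut t) ρ
    τ  = map (punchOut v) ρ′
    v∉ρ′ : v ∉ ρ′
    v∉ρ′ = ∉-map-punchOut-below v<t v∉ t∉
    lifted₁ : lift₁ τ ≡ ρ′
    lifted₁ = map-punchIn-punchOut v ρ′ v∉ρ′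
    lifted : lift₂ t τ ≡ ρ
    lifted = trans (cong (map (punchIn t)) lifted₁) (map-punchIn-punchOut t ρ t∉)
    perm : IsPerm n₂ τ
    perm = IsArrangement-punchOut (s≤s z≤n) (≤-pred (≤-trans v<t t≤n)) v∉ρ′
             (IsArrangement-punchOut (≤-trans (s≤s z≤n) v<t) t≤n t∉ arrangement)
    peaksρ′ : HasPeakSet ρ′ (S ∪[ suc v , n₁ ])
    peaksρ′ = HasPeakSet-punchIn⁻ t ρ′ (widen-t v<t t≤n)
                (subst (λ r → HasPeakSet r (λ x → Target x × x ≢ t)) (sym (map-punchIn-punchOut t ρ t∉)) peakSet)
    peaksτ : HasPeakSet τ (S ∪[ v , n₂ ])
    peaksτ = HasPeakSet-punchIn⁻ v τ shift-v (subst (λ r → HasPeakSet r (S ∪[ suc v , n₁ ])) (sym lifted₁) peaksρ′)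

  insertions₁⊆L : ∀ {ρ σ} → Reduced₁ ρ → σ ∈ insertions₁ v ρ → σ ∈ L
  insertions₁⊆L {ρ} {σ} red σ∈ with ∈-insertions₁⁻ v ρ σ∈
  ... | α , β , refl , refl = ∈-cpList⁺ (IsArrangement-insert α arrangement v∉ v∈[1,n])
    (HasPeakSet-peaks≡ (α ++ v ∷ β) (α ++ β) (peaks-insertions₁ v∉ isolated σ∈) peakSet)
    where open Reduced₁ red

  L∩insertions₁⇒Reduced₁ : ∀ {ρ σ} → σ ∈ L → σ ∈ insertions₁ v ρ → peaks σ ≡ peaks ρ → Reduced₁ ρ
  L∩insertions₁⇒Reduced₁ {ρ} σ∈L σ∈ peaks≡ with ∈-cpList⁻ σ∈L | ∈-insertions₁⁻ v ρ σ∈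
  ... | perm , peaksσ | α , β , refl , refl with IsArrangement-remove α perm
  ... | arrangement , v∉ , _ = record
    { arrangement = arrangement ; v∉ = v∉ ; peakSet = HasPeakSet-peaks≡ (α ++ β) (α ++ v ∷ β) (sym peaks≡) peaksσ }

  insertions₂⊆L : ∀ {t ρ σ} → Reduced₂ t ρ → σ ∈ insertions₂ v t ρ → σ ∈ L
  insertions₂⊆L {t} {ρ} {σ} red σ∈ with ∈-insertions₂⁻ v t ρ σ∈
  ... | α , β , refl , form = ∈-cpList⁺
    (IsArrangement-insert₂ α β form arrangement v∉ t∉ (<⇒≢ v<t) v∈[1,n] (≤-trans (s≤s z≤n) v<t , t≤n))
    (HasPeakSet-AddsPeak⁺ (α ++ β) σ (peaks-insertions₂ v∉ isolated v<t nonempty σ∈) (inj₂ (v<t , t≤n)) peakSet)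
    where open Reduced₂ red

  L∩insertions₂⇒Reduced₂ : ∀ {t ρ σ} → σ ∈ L → v < t → σ ∈ insertions₂ v t ρ → AddsPeak t ρ σ → Reduced₂ t ρ
  L∩insertions₂⇒Reduced₂ {t} {ρ} {σ} σ∈L v<t σ∈ adds with ∈-cpList⁻ σ∈L | ∈-insertions₂⁻ v t ρ σ∈
  ... | perm , peaksσ | α , β , refl , form with IsArrangement-remove₂ α β form perm
  ... | arrangement , v∉ , t∉ , _ , t≤n = record
    { v<t = v<t ; t≤n = t≤n ; arrangement = arrangement ; v∉ = v∉ ; t∉ = t∉
    ; peakSet = HasPeakSet-AddsPeak⁻ (α ++ β) σ t∉ adds peaksσ }

  M₁⊆L : ∀ {σ} → σ ∈ M₁ → σ ∈ L
  M₁⊆L σ∈ with ∈-concatMap-elim (insertions₁ v ∘ lift₁) σ∈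
  ... | τ , τ∈ , σ∈′ = insertions₁⊆L (lift₁-reduced τ∈) σ∈′

  M₂⊆L : ∀ {σ} → σ ∈ M₂ → σ ∈ L
  M₂⊆L σ∈ with ∈-concatMap-elim family₂ σ∈
  ... | τ , τ∈ , σ∈′ with ∈-concatMap-elim (λ t → insertions₂ v t (lift₂ t τ)) σ∈′
  ... | t , t∈ , σ∈″ = insertions₂⊆L (lift₂-reduced τ∈ t∈) σ∈″

  L⊆M : ∀ {σ} → σ ∈ L → σ ∈ M₁ ++ M₂
  L⊆M {σ} σ∈L with ∈-cpList⁻ σ∈L
  ... | perm@(_ , unique , bounds) , peaksσ
    with decompose unique peaksAbove (λ p → above-v⇒≢v (proj₁ peaksσ v p) refl) (IsPerm-∈ perm v∈[1,n])
    where
    peaksAbove : PeaksAbove v σ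
    peaksAbove x x∈ v<x = proj₂ peaksσ x (inj₂ (v<x , proj₂ (All.lookup bounds x∈)))
  ... | inj₁ (ρ , σ∈ , peaks≡) with lower₁ (L∩insertions₁⇒Reduced₁ σ∈L σ∈ peaks≡)
  ...   | τ∈ , lifted = ∈-++⁺ˡ (∈-concatMap-intro (insertions₁ v ∘ lift₁) τ∈
                          (subst (λ r → σ ∈ insertions₁ v r) (sym lifted) σ∈))
  L⊆M {σ} σ∈L | _ | inj₂ (t , ρ , v<t , σ∈ , adds) with L∩insertions₂⇒Reduced₂ σ∈L v<t σ∈ adds
  ... | red with lower₂ red
  ...   | τ∈ , lifted = ∈-++⁺ʳ M₁ (∈-concatMap-intro family₂ τ∈
          (∈-concatMap-intro (λ t → insertions₂ v t (lift₂ t _)) (∈-range⁺ v<t (Reduced₂.t≤n red))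
            (subst (λ r → σ ∈ insertions₂ v t r) (sym lifted) σ∈)))

  lift₁-injective : ∀ {τ₁ τ₂} → lift₁ τ₁ ≡ lift₁ τ₂ → τ₁ ≡ τ₂
  lift₁-injective = map-injective (punchIn-injective v)

  lift₂-injective : ∀ {t τ₁ τ₂} → lift₂ t τ₁ ≡ lift₂ t τ₂ → τ₁ ≡ τ₂
  lift₂-injective {t} = lift₁-injective ∘ map-injective (punchIn-injective t)

  Unique-M₁ : Unique M₁
  Unique-M₁ = Unique-concatMap (insertions₁ v ∘ lift₁) (Unique-cpList n₁ (S ++ range v n₁))
    (λ τ∈ → let open Reduced₁ (lift₁-reduced τ∈) in Unique-insertions₁ v _ v∉ nonempty isolated)
    λ τ₁∈ τ₂∈ z∈₁ z∈₂ → lift₁-injective (trans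
      (sym (remove-insertions₁ (Reduced₁.v∉ (lift₁-reduced τ₁∈)) z∈₁))
      (remove-insertions₁ (Reduced₁.v∉ (lift₁-reduced τ₂∈)) z∈₂))

  partner≡ : ∀ {τ t z} → τ ∈ B → t ∈ tops → z ∈ insertions₂ v t (lift₂ t τ) → partner v z ≡ t
  partner≡ τ∈ t∈ = let open Reduced₂ (lift₂-reduced τ∈ t∈) in partner-insertions₂ v<t v∉

  Unique-family₂ : ∀ {τ} → τ ∈ B → Unique (family₂ τ)
  Unique-family₂ τ∈ = Unique-concatMap _ (Unique-range (suc v) n)
    (λ t∈ → let open Reduced₂ (lift₂-reduced τ∈ t∈) in Unique-insertions₂ v _ _ v∉ (<⇒≢ v<t))
    λ t₁∈ t₂∈ z∈₁ z∈₂ → trans (sym (partner≡ τ∈ t₁∈ z∈₁)) (partner≡ τ∈ t₂∈ z∈₂)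

  Unique-M₂ : Unique M₂
  Unique-M₂ = Unique-concatMap family₂ (Unique-cpList n₂ (S ++ range v n₂)) Unique-family₂ shared
    where
    shared : ∀ {τ₁ τ₂ z} → τ₁ ∈ B → τ₂ ∈ B → z ∈ family₂ τ₁ → z ∈ family₂ τ₂ → τ₁ ≡ τ₂
    shared {τ₁} {τ₂} τ₁∈ τ₂∈ z∈₁ z∈₂
      with ∈-concatMap-elim (λ t → insertions₂ v t (lift₂ t τ₁)) z∈₁
         | ∈-concatMap-elim (λ t → insertions₂ v t (lift₂ t τ₂)) z∈₂
    ... | t , t∈ , z∈₁′ | t′ , t′∈ , z∈₂′ with trans (sym (partner≡ τ₁∈ t∈ z∈₁′)) (partner≡ τ₂∈ t′∈ z∈₂′)
    ... | refl = lift₂-injective {t} (trans (sym (removed τ₁∈ z∈₁′)) (removed τ₂∈ z∈₂′))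
      where
      removed : ∀ {τ z} → τ ∈ B → z ∈ insertions₂ v t (lift₂ t τ) → remove t (remove v z) ≡ lift₂ t τ
      removed τ∈ z∈ = let open Reduced₂ (lift₂-reduced τ∈ t∈) in remove-insertions₂ v<t v∉ t∉ z∈

  Disjoint-M₁-M₂ : ∀ {z} → z ∈ M₁ → z ∉ M₂
  Disjoint-M₁-M₂ z∈₁ z∈₂ with ∈-concatMap-elim (insertions₁ v ∘ lift₁) z∈₁ | ∈-concatMap-elim family₂ z∈₂
  ... | τ , τ∈ , z∈₁′ | τ′ , τ′∈ , z∈₂′ with ∈-concatMap-elim (λ t → insertions₂ v t (lift₂ t τ′)) z∈₂′
  ... | t , t∈ , z∈₂″ = ¬FlankedAbove-insertions₁ R₁.v∉ R₁.nonempty R₁.isolated z∈₁′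
                           (FlankedAbove-insertions₂ R₂.v<t R₂.v∉ z∈₂″)
    where
    module R₁ = Reduced₁ (lift₁-reduced τ∈)
    module R₂ = Reduced₂ (lift₂-reduced τ′∈ t∈)

  length-L : length L ≡ length M₁ + length M₂
  length-L = trans
    (unique∧sameElems⇒length≡ (Unique-cpList n (S ++ range (suc v) n)) (++⁺ Unique-M₁ Unique-M₂ (λ (p , q) → Disjoint-M₁-M₂ p q))
      L⊆M λ p → [ M₁⊆L , M₂⊆L ]′ (∈-++⁻ M₁ p))
    (length-++ M₁)

  k : ℕ
  k = n₁ ∸ u

  length-M₁ : length M₁ ≡ (2 + 2 * k) * length A
  length-M₁ = length-concatMap-const (insertions₁ v ∘ lift₁) _ A λ {τ} τ∈ →
    trans (length-insertions₁ v (lift₁ τ))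
      (cong (λ c → 2 + 2 * c) (trans (countAbove-map (punchIn v) τ (above-punchIn-self u))
                                      (countAbove-perm u (proj₁ (∈-cpList⁻ {S = S} {v} {n₁} τ∈)))))

  length-family₂ : ∀ {τ} → τ ∈ B → length (family₂ τ) ≡ (2 + (n₂ ∸ u)) * k
  length-family₂ {τ} τ∈ = trans
    (length-concatMap-const (λ t → insertions₂ v t (lift₂ t τ)) _ tops λ {t} t∈ →
      trans (length-insertions₂ v t (lift₂ t τ))
        (cong (2 +_) (trans (countAbove-map (punchIn t) (lift₁ τ) (above-punchIn-higher (proj₁ (∈-range⁻ {suc v} {n} t∈))))
                       (trans (countAbove-map (punchIn v) τ (above-punchIn-self u))
                              (countAbove-perm u (proj₁ (∈-cpList⁻ {S = S} {v} {n₂} τ∈)))))))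
    (cong ((2 + (n₂ ∸ u)) *_) (length-range (suc v) n))

  length-M₂ : length M₂ ≡ (2 + (n₂ ∸ u)) * k * length B
  length-M₂ = length-concatMap-const family₂ _ B length-family₂

  cp-count : cp n (S ++ range (suc v) n)
    ≡ (2 + 2 * k) * cp n₁ (S ++ range v n₁) + (2 + (n₂ ∸ u)) * k * cp n₂ (S ++ range v n₂)
  cp-count = begin
    cp n (S ++ range (suc v) n)                              ≡⟨ cp≡length-cpList n _ ⟩
    length L                                                 ≡⟨ length-L ⟩
    length M₁ + length M₂                                    ≡⟨ cong₂ _+_ length-M₁ length-M₂ ⟩
    (2 + 2 * k) * length A + (2 + (n₂ ∸ u)) * k * length B   ≡⟨ cong₂ (λ a b → (2 + 2 * k) * a + (2 + (n₂ ∸ u)) * k * b)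
                                                                      (cp≡length-cpList n₁ _) (cp≡length-cpList n₂ _) ⟨
    (2 + 2 * k) * cp n₁ (S ++ range v n₁) + (2 + (n₂ ∸ u)) * k * cp n₂ (S ++ range v n₂) ∎
    where open ≡-Reasoning

2+2*k≡2*[k+1] : ∀ k → 2 + 2 * k ≡ 2 * (k + 1)
2+2*k≡2*[k+1] k = trans (+-comm 2 (2 * k)) (sym (*-distribˡ-+ 2 k 1))

pair-coefficient : ∀ a b → b ≤ suc a → (2 + (a ∸ b)) * (suc a ∸ b) ≡ (suc a ∸ b) * (suc a ∸ b + 1)
pair-coefficient a       zero    _         = trans (*-comm (2 + a) (suc a)) (cong (λ c → suc a * suc c) (sym (+-comm a 1)))
pair-coefficient zero    (suc zero) _      = refl
pair-coefficient zero    (suc (suc b)) (s≤s ())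
pair-coefficient (suc a) (suc b) (s≤s b≤) = pair-coefficient a b b≤

cp-recurrence : ∀ v n S → 2 ≤ v → v ≤ n → All (_< v) S →
  cp n (S ++ range (suc v) n)
    ≡ 2 * (n ∸ v + 1) * cp (n ∸ 1) (S ++ range v (n ∸ 1))
      + (n ∸ v) * (n ∸ v + 1) * cp (n ∸ 2) (S ++ range v (n ∸ 2))
cp-recurrence (suc u) (suc zero)       S (s≤s 1≤u) (s≤s u≤0) with () ← ≤-trans 1≤u u≤0
cp-recurrence (suc u) (suc (suc n₂)) S (s≤s 1≤u) (s≤s u≤n₁) S<v =
  trans (Counting.cp-count u n₂ S 1≤u u≤n₁ S<v)
    (cong₂ _+_ (cong (_* cp (suc n₂) (S ++ range (suc u) (suc n₂))) (2+2*k≡2*[k+1] (suc n₂ ∸ u)))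
               (cong (_* cp n₂ (S ++ range (suc u) n₂)) (pair-coefficient n₂ u u≤n₁)))

lemma3p2 : (k n : ℕ) (S : List ℕ) → k + 4 ≤ n →
    All (λ x → 3 ≤ x × x ≤ n ∸ k ∸ 1) S → cp n S ≢ 0 →
    cp n (S ++ range (n ∸ k + 1) n)
      ≡ 2 * (k + 1) * cp (n ∸ 1) (S ++ range (n ∸ k) (n ∸ 1))
        + k * (k + 1) * cp (n ∸ 2) (S ++ range (n ∸ k) (n ∸ 2))
lemma3p2 k n S k+4≤n S-bounds _ =
  subst₂ (λ a j → cp n (S ++ range a n) ≡ 2 * (j + 1) * cp (n ∸ 1) (S ++ range (n ∸ k) (n ∸ 1))
                                          + j * (j + 1) * cp (n ∸ 2) (S ++ range (n ∸ k) (n ∸ 2)))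
    (+-comm 1 (n ∸ k)) (m∸[m∸n]≡n k≤n)
    (cp-recurrence (n ∸ k) n S (≤-trans (s≤s (s≤s z≤n)) 4≤v) (m∸n≤m n k) (All.map (below-v ∘ proj₂) S-bounds))
  where
  k≤n : k ≤ n
  k≤n = ≤-trans (m≤m+n k 4) k+4≤n
  4≤v : 4 ≤ n ∸ k
  4≤v = subst (_≤ n ∸ k) (m+n∸m≡n k 4) (∸-monoˡ-≤ k k+4≤n)
  below-v : ∀ {x} → x ≤ n ∸ k ∸ 1 → x < n ∸ k
  below-v x≤ = ≤-trans (s≤s x≤) (≤-reflexive (m+[n∸m]≡n (≤-trans (s≤s z≤n) 4≤v)))
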